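{- Let $p$ be a prime and let $f:A\to X$ be an immersion between two connected graphs such that $f_*:H_1(A,\mathbb Z/p\mathbb Z)\to H_1(X,\mathbb Z/p\mathbb Z)$ is an isomorphism. Let $X'\to X$ be a regular cover of degree $p$ and let $\hat f:A\otimes_X X'\to X'$ be the natural projection (a lift of $f$). Then $A\otimes_X X'$ is connected and $\hat f_*:H_1(A\otimes_X X',\mathbb Z/p\mathbb Z)\to H_1(X',\mathbb Z/p\mathbb Z)$ is an isomorphism.
   Context: Graphs are $1$-dimensional CW complexes; a morphism of graphs is a cellular map sending each open edge homeomorphically onto an open edge; an immersion is a locally injective morphism. For graph morphisms $A\to X$, $B\to X$, the fiber product $A\otimes_X B$ is the graph whose vertices (resp. edges) are pairs of vertices (resp. edges) of $A$ and $B$ with the same image in $X$; it comes with natural projections to $A$ and $B$. -}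

module Defs where

open import Data.Nat using (ℕ; zero; suc)
open import Data.Fin using (Fin; zero; suc; _≟_)
open import Data.Integer using (ℤ; 0ℤ; 1ℤ; +_; _+_; _-_; _*_)
open import Data.Integer.Divisibility using (_∣_)
open import Data.Product using (Σ; ∃; _×_; _,_)
open import Data.Bool using (if_then_else_)
open import Relation.Nullary.Decidable using (⌊_⌋)
open import Relation.Binary.PropositionalEquality using (_≡_)
open import Relation.Binary.Construct.Closure.ReflexiveTransitive using (Star)
open import Function.Bundles using (_↔_)
open import Data.Sum using (_⊎_)

record Graph : Set where
  field
    nV nE : ℕ
    src tgt : Fin nE → Fin nV
open Graph public

V : Graph → Set
V G = Fin (nV G)

E : Graph → Set
E G = Fin (nE G)

record Hom (A X : Graph) : Set where
  field
    vmap : V A → V X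
    emap : E A → E X
    src-hom : ∀ e → src X (emap e) ≡ vmap (src A e)
    tgt-hom : ∀ e → tgt X (emap e) ≡ vmap (tgt A e)
open Hom public

Immersion : {A X : Graph} → Hom A X → Set
Immersion {A} f =
  (∀ e₁ e₂ → emap f e₁ ≡ emap f e₂ → src A e₁ ≡ src A e₂ → e₁ ≡ e₂) ×
  (∀ e₁ e₂ → emap f e₁ ≡ emap f e₂ → tgt A e₁ ≡ tgt A e₂ → e₁ ≡ e₂)

Covering : {A X : Graph} → Hom A X → Set
Covering {A} {X} f =
  Immersion f ×
  (∀ v (x : E X) → src X x ≡ vmap f v → ∃ λ e → src A e ≡ v × emap f e ≡ x) ×
  (∀ v (x : E X) → tgt X x ≡ vmap f v → ∃ λ e → tgt A e ≡ v × emap f e ≡ x)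

Adj : (G : Graph) → V G → V G → Set
Adj G u v = ∃ λ (e : E G) → (src G e ≡ u × tgt G e ≡ v) ⊎ (src G e ≡ v × tgt G e ≡ u)

Connected : Graph → Set
Connected G = ∀ (u v : V G) → Star (Adj G) u v

IsDeck : {X' X : Graph} → Hom X' X → Hom X' X' → Set
IsDeck {X'} c d =
  (Σ (Hom X' X') λ d' →
     (∀ v → vmap d (vmap d' v) ≡ v) × (∀ v → vmap d' (vmap d v) ≡ v) ×
     (∀ e → emap d (emap d' e) ≡ e) × (∀ e → emap d' (emap d e) ≡ e)) ×
  (∀ v → vmap c (vmap d v) ≡ vmap c v) × (∀ e → emap c (emap d e) ≡ emap c e)

record RegularCover (p : ℕ) {X' X : Graph} (c : Hom X' X) : Set where
  field
    connected : Connected X'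
    covering  : Covering c
    degree    : ∀ (x : V X) → Fin p ↔ Σ (V X') (λ v → vmap c v ≡ x)
    regular   : ∀ (v w : V X') → vmap c v ≡ vmap c w →
                ∃ λ (d : Hom X' X') → IsDeck c d × vmap d v ≡ w

-- P (with projections πA, πB) is the fiber product A ⊗_X B: its vertices
-- (resp. edges) correspond bijectively, via the projections, to pairs of
-- vertices (resp. edges) with the same image in X.
record IsFiberProduct {A B X P : Graph} (f : Hom A X) (g : Hom B X)
                      (πA : Hom P A) (πB : Hom P B) : Set where
  field
    v-comm : ∀ v → vmap f (vmap πA v) ≡ vmap g (vmap πB v)
    e-comm : ∀ e → emap f (emap πA e) ≡ emap g (emap πB e)
    v-inj  : ∀ v w → vmap πA v ≡ vmap πA w → vmap πB v ≡ vmap πB w → v ≡ w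
    e-inj  : ∀ e e' → emap πA e ≡ emap πA e' → emap πB e ≡ emap πB e' → e ≡ e'
    v-surj : ∀ a b → vmap f a ≡ vmap g b → ∃ λ v → vmap πA v ≡ a × vmap πB v ≡ b
    e-surj : ∀ a b → emap f a ≡ emap g b → ∃ λ e → emap πA e ≡ a × emap πB e ≡ b

-- Homology H₁(G; ℤ/p) = 1-cycles with ℤ/p coefficients (no 2-cells).
-- ℤ/p-chains are represented by ℤ-valued chains, compared modulo p.

sumFin : (n : ℕ) → (Fin n → ℤ) → ℤ
sumFin zero    h = 0ℤ
sumFin (suc n) h = h zero + sumFin n (λ i → h (suc i))

_≡[mod_]_ : ℤ → ℕ → ℤ → Set
a ≡[mod p ] b = (+ p) ∣ (a - b)

ind : {n : ℕ} → Fin n → Fin n → ℤ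
ind i j = if ⌊ i ≟ j ⌋ then 1ℤ else 0ℤ

Chain : Graph → Set
Chain G = E G → ℤ

boundary : (G : Graph) → Chain G → V G → ℤ
boundary G c v = sumFin (nE G) (λ e → c e * (ind (tgt G e) v - ind (src G e) v))

IsCycle : (p : ℕ) (G : Graph) → Chain G → Set
IsCycle p G c = ∀ v → boundary G c v ≡[mod p ] 0ℤ

push : {A X : Graph} → Hom A X → Chain A → Chain X
push {A} f c x = sumFin (nE A) (λ e → c e * ind (emap f e) x)

H1Iso : (p : ℕ) {A X : Graph} → Hom A X → Set
H1Iso p {A} {X} f =
  (∀ (c : Chain A) → IsCycle p A c → (∀ x → push f c x ≡[mod p ] 0ℤ) →
     ∀ e → c e ≡[mod p ] 0ℤ) ×
  (∀ (z : Chain X) → IsCycle p X z →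
     ∃ λ (c : Chain A) → IsCycle p A c × (∀ x → push f c x ≡[mod p ] z x))

-- Over 𝔽_p, a map f : A → X of connected graphs (A nonempty) induces isomorphisms on H₀ and
-- H₁ exactly when its mapping cone  C₁(A) → C₁(X) ⊕ C₀(A) → C₀(X)  is exact.  The regular
-- cover X′ → X of degree p has a deck transformation σ of order p acting freely on cells, and
-- so does A ⊗_X X′; hence the cone of f̂ is a complex of free 𝔽_p[ℤ/p]-modules whose
-- coinvariants (sums over σ-orbits) form the cone of f.  On free modules ker π = im N and
-- ker N = im T, where N = σ − 1, T is the norm and π the coinvariant map, while Nᵖ = σᵖ − 1 = 0
-- over 𝔽_p.  So a cycle of the upper cone is a boundary plus N applied to a cycle; iterating
-- p times kills the N-term, the cone of f̂ is exact, and f̂ is an H₀- and H₁-isomorphism.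

module Submission where

open import Defs
open import Data.Nat as ℕ using (ℕ; zero; suc; _≤_; _<_; s≤s; z≤n; NonZero; _%_; _/_)
import Data.Nat.Properties as ℕ
open import Data.Nat.Divisibility using (_∣_; divides; ∣⇒≤)
open import Data.Nat.DivMod using (m≡m%n+[m/n]*n; m%n<n)
open import Data.Nat.Combinatorics using (_C_; nCn≡1; nC1≡n; nCk+nC[k+1]≡[n+1]C[k+1]; k>n⇒nCk≡0)
open import Data.Nat.Primality using (Prime; euclidsLemma; prime⇒nonTrivial; prime⇒irreducible; ¬prime[0])
open import Data.Nat.GeneralisedArithmetic using (fold; fold-+)
open import Data.Nat.Induction using (<-rec)
import Data.Nat.Tactic.RingSolver as ℕ-Solver
open import Data.Fin using (Fin; zero; suc; toℕ; fromℕ<; _≟_)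
import Data.Fin.Properties as Fin
open import Data.Integer using (ℤ; 0ℤ; 1ℤ; +_; _+_; _-_; _*_; -_; ∣_∣)
import Data.Integer.Properties as ℤ
import Data.Integer.Divisibility.Signed as Signed
open import Data.Integer.Tactic.RingSolver using (solve-∀)
open import Algebra.Properties.CommutativeSemigroup ℤ.+-commutativeSemigroup using (interchange)
open import Algebra.Properties.Ring ℤ.+-*-ring using (x[y-z]≈xy-xz)
open import Data.Bool using (Bool; true; false; _∨_; if_then_else_)
import Data.Bool.Properties as Bool
open import Data.Empty using (⊥; ⊥-elim)
open import Data.Product using (Σ; ∃; ∃₂; _,_; _×_; proj₁; proj₂)
open import Data.Product.Properties using (Σ-≡,≡→≡)
open import Data.Sum using (_⊎_; inj₁; inj₂)
import Data.Sum as Sum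
open import Function using (_∘_)
open import Function.Bundles using (Inverse)
open import Axiom.UniquenessOfIdentityProofs using (module Decidable⇒UIP)
open import Relation.Nullary using (Dec; does; yes; no; ¬_; contradiction)
open import Relation.Nullary.Decidable using (_×-dec_; _⊎-dec_)
open import Relation.Binary using (IsEquivalence; Setoid)
open import Relation.Binary.Definitions using (tri<; tri≈; tri>)
open import Relation.Binary.PropositionalEquality
import Relation.Binary.Reasoning.Setoid
open import Relation.Binary.Construct.Closure.ReflexiveTransitive using (Star; ε; _◅_; _◅◅_)

infixr 8 _^_
_^_ : ∀ {A : Set} → (A → A) → ℕ → A → A
(f ^ k) x = fold x f k

^-+ : ∀ {A : Set} (f : A → A) m n x → (f ^ (m ℕ.+ n)) x ≡ (f ^ m) ((f ^ n) x)
^-+ f m n x = fold-+ x f m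

^-suc : ∀ {A : Set} (f : A → A) k x → (f ^ suc k) x ≡ (f ^ k) (f x)
^-suc f k x = trans (cong (λ m → (f ^ m) x) (ℕ.+-comm 1 k)) (^-+ f k 1 x)

^-∸ : ∀ {A : Set} (f : A → A) x {a b} → a ℕ.≤ b → (f ^ (b ℕ.∸ a)) ((f ^ a) x) ≡ (f ^ b) x
^-∸ f x {a} {b} a≤b = trans (sym (^-+ f (b ℕ.∸ a) a x)) (cong (λ n → (f ^ n) x) (ℕ.m∸n+n≡m a≤b))

-- Integer chains on finite sets: sums, pushforward and boundary

sumFin-cong : ∀ n {g h : Fin n → ℤ} → (∀ i → g i ≡ h i) → sumFin n g ≡ sumFin n h
sumFin-cong zero    eq = refl
sumFin-cong (suc n) eq = cong₂ _+_ (eq zero) (sumFin-cong n (eq ∘ suc))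

sumFin-zero : ∀ n → sumFin n (λ _ → 0ℤ) ≡ 0ℤ
sumFin-zero zero    = refl
sumFin-zero (suc n) = trans (ℤ.+-identityˡ _) (sumFin-zero n)

sumFin-empty : ∀ n h → ¬ Fin n → sumFin n h ≡ 0ℤ
sumFin-empty zero    h _     = refl
sumFin-empty (suc n) h empty = ⊥-elim (empty zero)

sumFin-const : ∀ n a → sumFin n (λ _ → a) ≡ + n * a
sumFin-const zero    a = sym (ℤ.*-zeroˡ a)
sumFin-const (suc n) a = begin
  a + sumFin n (λ _ → a)  ≡⟨ cong (_+_ (a)) (sumFin-const n a) ⟩
  a + + n * a             ≡⟨ cong (_+ + n * a) (sym (ℤ.*-identityˡ a)) ⟩
  + 1 * a + + n * a       ≡⟨ sym (ℤ.*-distribʳ-+ a (+ 1) (+ n)) ⟩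
  (+ 1 + + n) * a         ≡⟨ cong (_* a) (sym (ℤ.pos-+ 1 n)) ⟩
  + suc n * a             ∎
  where open ≡-Reasoning

sumFin-distrib-+ : ∀ n (g h : Fin n → ℤ) →
                   sumFin n (λ i → g i + h i) ≡ sumFin n g + sumFin n h
sumFin-distrib-+ zero    g h = refl
sumFin-distrib-+ (suc n) g h =
  trans (cong (_+_ (g zero + h zero)) (sumFin-distrib-+ n (g ∘ suc) (h ∘ suc)))
        (interchange (g zero) (h zero) _ _)

*-distribˡ-sumFin : ∀ n a (h : Fin n → ℤ) → a * sumFin n h ≡ sumFin n (λ i → a * h i)
*-distribˡ-sumFin zero    a h = ℤ.*-zeroʳ a
*-distribˡ-sumFin (suc n) a h =
  trans (ℤ.*-distribˡ-+ a (h zero) _) (cong (_+_ (a * h zero)) (*-distribˡ-sumFin n a (h ∘ suc)))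

*-distribʳ-sumFin : ∀ n a (h : Fin n → ℤ) → sumFin n h * a ≡ sumFin n (λ i → h i * a)
*-distribʳ-sumFin n a h =
  trans (ℤ.*-comm _ a) (trans (*-distribˡ-sumFin n a h) (sumFin-cong n (λ i → ℤ.*-comm a (h i))))

neg-distrib-sumFin : ∀ n (h : Fin n → ℤ) → - sumFin n h ≡ sumFin n (λ i → - h i)
neg-distrib-sumFin zero    h = refl
neg-distrib-sumFin (suc n) h =
  trans (ℤ.neg-distrib-+ (h zero) _) (cong (_+_ (- h zero)) (neg-distrib-sumFin n (h ∘ suc)))

sumFin-- : ∀ n (g h : Fin n → ℤ) → sumFin n (λ i → g i - h i) ≡ sumFin n g - sumFin n h
sumFin-- n g h = trans (sumFin-distrib-+ n g (λ i → - h i)) (cong (_+_ (sumFin n g)) (sym (neg-distrib-sumFin n h)))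

[x-y]z≡xz-yz : ∀ x y z → (x - y) * z ≡ x * z - y * z
[x-y]z≡xz-yz = solve-∀

sumFin-comm : ∀ m n (h : Fin m → Fin n → ℤ) →
              sumFin m (λ i → sumFin n (h i)) ≡ sumFin n (λ j → sumFin m (λ i → h i j))
sumFin-comm zero    n h = sym (sumFin-zero n)
sumFin-comm (suc m) n h =
  trans (cong (_+_ (sumFin n (h zero))) (sumFin-comm m n (h ∘ suc)))
        (sym (sumFin-distrib-+ n (h zero) _))

ind-diag : ∀ {n} (i : Fin n) → ind i i ≡ 1ℤ
ind-diag i with i ≟ i
... | yes _  = refl
... | no i≢i = contradiction refl i≢i

ind-≢ : ∀ {n} {i j : Fin n} → i ≢ j → ind i j ≡ 0ℤ
ind-≢ {i = i} {j} i≢j with i ≟ j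
... | yes i≡j = contradiction i≡j i≢j
... | no _    = refl

ind-sym : ∀ {n} (i j : Fin n) → ind i j ≡ ind j i
ind-sym i j with i ≟ j
... | yes refl = sym (ind-diag i)
... | no i≢j   = sym (ind-≢ (i≢j ∘ sym))

ind-suc : ∀ {n} (i j : Fin n) → ind (suc i) (suc j) ≡ ind i j
ind-suc i j with i ≟ j
... | yes _ = refl
... | no _  = refl

ind-⇔ : ∀ {m n} {a b : Fin m} {a′ b′ : Fin n} → (a ≡ b → a′ ≡ b′) → (a′ ≡ b′ → a ≡ b) → ind a b ≡ ind a′ b′
ind-⇔ {a = a} {b} {a′} {b′} to from with a ≟ b | a′ ≟ b′
... | yes _   | yes _    = refl
... | no  _   | no  _    = refl
... | yes a≡b | no  a′≢b′ = contradiction (to a≡b) a′≢b′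
... | no  a≢b | yes a′≡b′ = contradiction (from a′≡b′) a≢b

sumFin-ind : ∀ n (a : Fin n) (h : Fin n → ℤ) → sumFin n (λ i → ind a i * h i) ≡ h a
sumFin-ind (suc n) zero h = begin
  ind {suc n} zero zero * h zero + sumFin n (λ i → ind zero (suc i) * h (suc i))
    ≡⟨ cong₂ _+_ (cong (_* h zero) (ind-diag {suc n} zero))
                 (sumFin-cong n (λ i → cong (_* h (suc i)) (ind-≢ {i = zero} {suc i} λ ()))) ⟩
  1ℤ * h zero + sumFin n (λ i → 0ℤ * h (suc i))
    ≡⟨ cong₂ _+_ (ℤ.*-identityˡ (h zero)) (sumFin-cong n (λ i → ℤ.*-zeroˡ (h (suc i)))) ⟩
  h zero + sumFin n (λ _ → 0ℤ)
    ≡⟨ trans (cong (_+_ (h zero)) (sumFin-zero n)) (ℤ.+-identityʳ (h zero)) ⟩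
  h zero ∎
  where open ≡-Reasoning
sumFin-ind (suc n) (suc a) h = begin
  ind (suc a) zero * h zero + sumFin n (λ i → ind (suc a) (suc i) * h (suc i))
    ≡⟨ cong₂ _+_ (trans (cong (_* h zero) (ind-≢ {i = suc a} {zero} λ ())) (ℤ.*-zeroˡ (h zero)))
                 (sumFin-cong n (λ i → cong (_* h (suc i)) (ind-suc a i))) ⟩
  0ℤ + sumFin n (λ i → ind a i * h (suc i))
    ≡⟨ trans (ℤ.+-identityˡ _) (sumFin-ind n a (h ∘ suc)) ⟩
  h (suc a) ∎
  where open ≡-Reasoning

sumFin-ind′ : ∀ n (a : Fin n) (h : Fin n → ℤ) → sumFin n (λ i → h i * ind i a) ≡ h a
sumFin-ind′ n a h = trans (sumFin-cong n (λ i → trans (ℤ.*-comm (h i) _) (cong (_* h i) (ind-sym i a)))) (sumFin-ind n a h)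

sumFin-indicator : ∀ n (a : Fin n) → sumFin n (ind a) ≡ 1ℤ
sumFin-indicator n a = trans (sumFin-cong n (λ i → sym (ℤ.*-identityʳ (ind a i)))) (sumFin-ind n a (λ _ → 1ℤ))

sumFin-ind-difference : ∀ n (u v : Fin n) (χ : Fin n → ℤ) → sumFin n (λ w → (ind v w - ind u w) * χ w) ≡ χ v - χ u
sumFin-ind-difference n u v χ = begin
  sumFin n (λ w → (ind v w - ind u w) * χ w)                      ≡⟨ sumFin-cong n (λ w → [x-y]z≡xz-yz (ind v w) (ind u w) (χ w)) ⟩
  sumFin n (λ w → ind v w * χ w - ind u w * χ w)                  ≡⟨ sumFin-- n (λ w → ind v w * χ w) (λ w → ind u w * χ w) ⟩
  sumFin n (λ w → ind v w * χ w) - sumFin n (λ w → ind u w * χ w) ≡⟨ cong₂ _-_ (sumFin-ind n v χ) (sumFin-ind n u χ) ⟩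
  χ v - χ u                                                       ∎
  where open ≡-Reasoning

pushforward : ∀ {m n} → (Fin m → Fin n) → (Fin m → ℤ) → Fin n → ℤ
pushforward {m} φ c y = sumFin m (λ i → c i * ind (φ i) y)

pushforward-≗ : ∀ {m n} (φ : Fin m → Fin n) {c d : Fin m → ℤ} → (∀ i → c i ≡ d i) → ∀ y → pushforward φ c y ≡ pushforward φ d y
pushforward-≗ {m} φ c≗d y = sumFin-cong m (λ i → cong (_* ind (φ i) y) (c≗d i))

pushforward-pairing : ∀ {m n} (φ : Fin m → Fin n) (c : Fin m → ℤ) (θ : Fin n → ℤ) →
  sumFin n (λ y → pushforward φ c y * θ y) ≡ sumFin m (λ i → c i * θ (φ i))
pushforward-pairing {m} {n} φ c θ = begin
  sumFin n (λ y → sumFin m (λ i → c i * ind (φ i) y) * θ y)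
    ≡⟨ sumFin-cong n (λ y → *-distribʳ-sumFin m (θ y) _) ⟩
  sumFin n (λ y → sumFin m (λ i → c i * ind (φ i) y * θ y))
    ≡⟨ sumFin-comm n m _ ⟩
  sumFin m (λ i → sumFin n (λ y → c i * ind (φ i) y * θ y))
    ≡⟨ sumFin-cong m (λ i → sumFin-cong n (λ y → ℤ.*-assoc (c i) _ (θ y))) ⟩
  sumFin m (λ i → sumFin n (λ y → c i * (ind (φ i) y * θ y)))
    ≡⟨ sumFin-cong m (λ i → sym (*-distribˡ-sumFin n (c i) _)) ⟩
  sumFin m (λ i → c i * sumFin n (λ y → ind (φ i) y * θ y))
    ≡⟨ sumFin-cong m (λ i → cong (c i *_) (sumFin-ind n (φ i) θ)) ⟩
  sumFin m (λ i → c i * θ (φ i)) ∎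
  where open ≡-Reasoning

pushforward-∘ : ∀ {l m n} (φ : Fin m → Fin n) (ψ : Fin l → Fin m) (c : Fin l → ℤ) z →
                pushforward φ (pushforward ψ c) z ≡ pushforward (φ ∘ ψ) c z
pushforward-∘ φ ψ c z = pushforward-pairing ψ c (λ j → ind (φ j) z)

sumFin-pushforward : ∀ {m n} (φ : Fin m → Fin n) (c : Fin m → ℤ) →
                     sumFin n (pushforward φ c) ≡ sumFin m c
sumFin-pushforward {m} {n} φ c =
  trans (sumFin-cong n (λ y → sym (ℤ.*-identityʳ _)))
        (trans (pushforward-pairing φ c (λ _ → 1ℤ)) (sumFin-cong m (λ i → ℤ.*-identityʳ (c i))))

pushforward-ind : ∀ {m n} (φ : Fin m → Fin n) (u : Fin m) y → pushforward φ (ind u) y ≡ ind (φ u) y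
pushforward-ind {m} φ u y = sumFin-ind m u (λ i → ind (φ i) y)

pushforward-cong : ∀ {m n} {φ ψ : Fin m → Fin n} → (∀ i → φ i ≡ ψ i) →
                   ∀ c y → pushforward φ c y ≡ pushforward ψ c y
pushforward-cong {m} eq c y = sumFin-cong m (λ i → cong (λ t → c i * ind t y) (eq i))

pushforward-+ : ∀ {m n} (φ : Fin m → Fin n) (c d : Fin m → ℤ) y →
  pushforward φ (λ i → c i + d i) y ≡ pushforward φ c y + pushforward φ d y
pushforward-+ {m} φ c d y =
  trans (sumFin-cong m (λ i → ℤ.*-distribʳ-+ (ind (φ i) y) (c i) (d i))) (sumFin-distrib-+ m _ _)

pushforward-neg : ∀ {m n} (φ : Fin m → Fin n) (c : Fin m → ℤ) y →
  pushforward φ (λ i → - c i) y ≡ - pushforward φ c y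
pushforward-neg {m} φ c y =
  trans (sumFin-cong m (λ i → sym (ℤ.neg-distribˡ-* (c i) _))) (sym (neg-distrib-sumFin m _))

pushforward-- : ∀ {m n} (φ : Fin m → Fin n) (c d : Fin m → ℤ) y →
  pushforward φ (λ i → c i - d i) y ≡ pushforward φ c y - pushforward φ d y
pushforward-- φ c d y =
  trans (pushforward-+ φ c (λ i → - d i) y) (cong (_+_ (pushforward φ c y)) (pushforward-neg φ d y))

pushforward-zero : ∀ {m n} (φ : Fin m → Fin n) y → pushforward φ (λ _ → 0ℤ) y ≡ 0ℤ
pushforward-zero {m} φ y = trans (sumFin-cong m (λ i → ℤ.*-zeroˡ (ind (φ i) y))) (sumFin-zero m)

pushforward-bijection : ∀ {n} {β α : Fin n → Fin n} → (∀ y → β (α y) ≡ y) → (∀ i → α (β i) ≡ i) →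
                        ∀ c y → pushforward β c y ≡ c (α y)
pushforward-bijection {n} {β} {α} βα αβ c y = begin
  sumFin n (λ i → c i * ind (β i) y)  ≡⟨ sumFin-cong n (λ i → cong (c i *_) (ind-transpose i)) ⟩
  sumFin n (λ i → c i * ind (α y) i)  ≡⟨ sumFin-cong n (λ i → ℤ.*-comm (c i) _) ⟩
  sumFin n (λ i → ind (α y) i * c i)  ≡⟨ sumFin-ind n (α y) c ⟩
  c (α y)                             ∎
  where
  open ≡-Reasoning
  ind-transpose : ∀ i → ind (β i) y ≡ ind (α y) i
  ind-transpose i with β i ≟ y
  ... | yes refl = sym (trans (cong (λ t → ind t i) (αβ i)) (ind-diag i))
  ... | no βi≢y  = sym (ind-≢ (λ αy≡i → βi≢y (trans (cong β (sym αy≡i)) (βα y))))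

sumFin-reindex : ∀ n {α β : Fin n → Fin n} → (∀ y → α (β y) ≡ y) → (∀ i → β (α i) ≡ i) →
                 ∀ h → sumFin n (h ∘ α) ≡ sumFin n h
sumFin-reindex n {α} {β} αβ βα h =
  trans (sumFin-cong n (λ y → sym (pushforward-bijection {β = β} {α} βα αβ h y))) (sumFin-pushforward β h)

-- Precomposition with a bijection is pushforward along its inverse, so equivariance
-- reduces to functoriality.
pushforward-equivariant :
  ∀ {m n} (φ : Fin m → Fin n) {α α⁻¹ : Fin m → Fin m} {γ γ⁻¹ : Fin n → Fin n} →
  (∀ i → α (α⁻¹ i) ≡ i) → (∀ i → α⁻¹ (α i) ≡ i) →
  (∀ y → γ (γ⁻¹ y) ≡ y) → (∀ y → γ⁻¹ (γ y) ≡ y) →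
  (∀ i → φ (α i) ≡ γ (φ i)) → ∀ c y → pushforward φ (c ∘ α) y ≡ pushforward φ c (γ y)
pushforward-equivariant φ {α} {α⁻¹} {γ} {γ⁻¹} αα⁻¹ α⁻¹α γγ⁻¹ γ⁻¹γ comm c y = begin
  pushforward φ (c ∘ α) y                  ≡⟨ pushforward-≗ φ (λ i → sym (pushforward-bijection α⁻¹α αα⁻¹ c i)) y ⟩
  pushforward φ (pushforward α⁻¹ c) y      ≡⟨ pushforward-∘ φ α⁻¹ c y ⟩
  pushforward (φ ∘ α⁻¹) c y                ≡⟨ pushforward-cong φα⁻¹ c y ⟩
  pushforward (γ⁻¹ ∘ φ) c y                ≡⟨ sym (pushforward-∘ γ⁻¹ φ c y) ⟩
  pushforward γ⁻¹ (pushforward φ c) y      ≡⟨ pushforward-bijection γ⁻¹γ γγ⁻¹ (pushforward φ c) y ⟩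
  pushforward φ c (γ y)                    ∎
  where
  open ≡-Reasoning
  φα⁻¹ : ∀ i → φ (α⁻¹ i) ≡ γ⁻¹ (φ i)
  φα⁻¹ i = trans (sym (γ⁻¹γ _)) (cong γ⁻¹ (trans (sym (comm (α⁻¹ i))) (cong φ (αα⁻¹ i))))

boundary-pushforward : ∀ G c v → boundary G c v ≡ pushforward (tgt G) c v - pushforward (src G) c v
boundary-pushforward G c v =
  trans (sumFin-cong (nE G) (λ e → ℤ.*-distribˡ-+ (c e) _ _))
        (trans (sumFin-distrib-+ (nE G) _ _)
               (cong (_+_ (pushforward (tgt G) c v))
                     (trans (sumFin-cong (nE G) (λ e → sym (ℤ.neg-distribʳ-* (c e) _)))
                            (sym (neg-distrib-sumFin (nE G) _)))))

boundary-≗ : ∀ G {c d : Chain G} → (∀ e → c e ≡ d e) → ∀ v → boundary G c v ≡ boundary G d v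
boundary-≗ G c≗d v = sumFin-cong (nE G) (λ e → cong (_* (ind (tgt G e) v - ind (src G e) v)) (c≗d e))

boundary-+ : ∀ G (c d : Chain G) v → boundary G (λ e → c e + d e) v ≡ boundary G c v + boundary G d v
boundary-+ G c d v = trans (sumFin-cong (nE G) (λ e → ℤ.*-distribʳ-+ _ (c e) (d e))) (sumFin-distrib-+ (nE G) _ _)

boundary-neg : ∀ G (c : Chain G) v → boundary G (λ e → - c e) v ≡ - boundary G c v
boundary-neg G c v = trans (sumFin-cong (nE G) (λ e → sym (ℤ.neg-distribˡ-* (c e) _))) (sym (neg-distrib-sumFin (nE G) _))

boundary-zero : ∀ G v → boundary G (λ _ → 0ℤ) v ≡ 0ℤ
boundary-zero G v =
  trans (sumFin-cong (nE G) (λ e → ℤ.*-zeroˡ (ind (tgt G e) v - ind (src G e) v))) (sumFin-zero (nE G))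

boundary-ind : ∀ G (e : E G) v → boundary G (ind e) v ≡ ind (tgt G e) v - ind (src G e) v
boundary-ind G e v = trans (boundary-pushforward G (ind e) v)
                           (cong₂ _-_ (pushforward-ind (tgt G) e v) (pushforward-ind (src G) e v))

boundary-push : ∀ {A X} (f : Hom A X) (c : Chain A) x →
                boundary X (push f c) x ≡ pushforward (vmap f) (boundary A c) x
boundary-push {A} {X} f c x = begin
  boundary X (push f c) x
    ≡⟨ boundary-pushforward X (push f c) x ⟩
  pushforward (tgt X) (push f c) x - pushforward (src X) (push f c) x
    ≡⟨ cong₂ _-_ (along (tgt X) (tgt A) (tgt-hom f)) (along (src X) (src A) (src-hom f)) ⟩
  pushforward (vmap f) (pushforward (tgt A) c) x - pushforward (vmap f) (pushforward (src A) c) x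
    ≡⟨ sym (pushforward-- (vmap f) (pushforward (tgt A) c) (pushforward (src A) c) x) ⟩
  pushforward (vmap f) (λ v → pushforward (tgt A) c v - pushforward (src A) c v) x
    ≡⟨ pushforward-≗ (vmap f) (λ v → sym (boundary-pushforward A c v)) x ⟩
  pushforward (vmap f) (boundary A c) x ∎
  where
  open ≡-Reasoning
  along : ∀ endX endA → (∀ e → endX (emap f e) ≡ vmap f (endA e)) →
          pushforward endX (push f c) x ≡ pushforward (vmap f) (pushforward endA c) x
  along endX endA hom = trans (pushforward-∘ endX (emap f) c x)
                              (trans (pushforward-cong hom c x) (sym (pushforward-∘ (vmap f) endA c x)))

boundary-pairing : ∀ G (a : Chain G) (χ : V G → ℤ) →
  sumFin (nV G) (λ v → boundary G a v * χ v) ≡ sumFin (nE G) (λ e → a e * (χ (tgt G e) - χ (src G e)))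
boundary-pairing G a χ = begin
  sumFin (nV G) (λ v → boundary G a v * χ v)
    ≡⟨ sumFin-cong (nV G) (λ v → cong (_* χ v) (boundary-pushforward G a v)) ⟩
  sumFin (nV G) (λ v → (pushforward (tgt G) a v - pushforward (src G) a v) * χ v)
    ≡⟨ sumFin-cong (nV G) (λ v → [x-y]z≡xz-yz (pushforward (tgt G) a v) (pushforward (src G) a v) (χ v)) ⟩
  sumFin (nV G) (λ v → pairedWith (tgt G) v - pairedWith (src G) v)
    ≡⟨ sumFin-- (nV G) (pairedWith (tgt G)) (pairedWith (src G)) ⟩
  sumFin (nV G) (pairedWith (tgt G)) - sumFin (nV G) (pairedWith (src G))
    ≡⟨ cong₂ _-_ (pushforward-pairing (tgt G) a χ) (pushforward-pairing (src G) a χ) ⟩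
  sumFin (nE G) (λ e → a e * χ (tgt G e)) - sumFin (nE G) (λ e → a e * χ (src G e))
    ≡⟨ sym (sumFin-- (nE G) (λ e → a e * χ (tgt G e)) (λ e → a e * χ (src G e))) ⟩
  sumFin (nE G) (λ e → a e * χ (tgt G e) - a e * χ (src G e))
    ≡⟨ sumFin-cong (nE G) (λ e → sym (x[y-z]≈xy-xz (a e) (χ (tgt G e)) (χ (src G e)))) ⟩
  sumFin (nE G) (λ e → a e * (χ (tgt G e) - χ (src G e))) ∎
  where
  open ≡-Reasoning
  pairedWith : (E G → V G) → V G → ℤ
  pairedWith end v = pushforward end a v * χ v

sumFin-boundary : ∀ G (a : Chain G) → sumFin (nV G) (boundary G a) ≡ 0ℤ
sumFin-boundary G a = begin
  sumFin (nV G) (boundary G a)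
    ≡⟨ sumFin-cong (nV G) (λ v → sym (ℤ.*-identityʳ _)) ⟩
  sumFin (nV G) (λ v → boundary G a v * 1ℤ)
    ≡⟨ boundary-pairing G a (λ _ → 1ℤ) ⟩
  sumFin (nE G) (λ e → a e * 0ℤ)
    ≡⟨ trans (sumFin-cong (nE G) (λ e → ℤ.*-zeroʳ (a e))) (sumFin-zero (nE G)) ⟩
  0ℤ ∎
  where open ≡-Reasoning

boundary-lincomb : ∀ G m (a : Fin m → ℤ) (c : Fin m → Chain G) w →
  boundary G (λ e → sumFin m (λ k → a k * c k e)) w ≡ sumFin m (λ k → a k * boundary G (c k) w)
boundary-lincomb G m a c w = begin
  sumFin (nE G) (λ e → sumFin m (λ k → a k * c k e) * D e)
    ≡⟨ sumFin-cong (nE G) (λ e → *-distribʳ-sumFin m (D e) _) ⟩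
  sumFin (nE G) (λ e → sumFin m (λ k → a k * c k e * D e))
    ≡⟨ sumFin-comm (nE G) m _ ⟩
  sumFin m (λ k → sumFin (nE G) (λ e → a k * c k e * D e))
    ≡⟨ sumFin-cong m (λ k → trans (sumFin-cong (nE G) (λ e → ℤ.*-assoc (a k) (c k e) (D e)))
                                   (sym (*-distribˡ-sumFin (nE G) (a k) _))) ⟩
  sumFin m (λ k → a k * boundary G (c k) w) ∎
  where
  open ≡-Reasoning
  D : E G → ℤ
  D e = ind (tgt G e) w - ind (src G e) w

boundary-equivariant :
  ∀ G {α α⁻¹ : E G → E G} {γ γ⁻¹ : V G → V G} →
  (∀ e → α (α⁻¹ e) ≡ e) → (∀ e → α⁻¹ (α e) ≡ e) → (∀ v → γ (γ⁻¹ v) ≡ v) → (∀ v → γ⁻¹ (γ v) ≡ v) →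
  (∀ e → src G (α e) ≡ γ (src G e)) → (∀ e → tgt G (α e) ≡ γ (tgt G e)) →
  ∀ c v → boundary G (c ∘ α) v ≡ boundary G c (γ v)
boundary-equivariant G {α} {α⁻¹} {γ} {γ⁻¹} αα⁻¹ α⁻¹α γγ⁻¹ γ⁻¹γ src-α tgt-α c v = begin
  boundary G (c ∘ α) v                                                      ≡⟨ boundary-pushforward G (c ∘ α) v ⟩
  pushforward (tgt G) (c ∘ α) v - pushforward (src G) (c ∘ α) v             ≡⟨ cong₂ _-_ (equivariant (tgt G) tgt-α) (equivariant (src G) src-α) ⟩
  pushforward (tgt G) c (γ v) - pushforward (src G) c (γ v)                 ≡⟨ sym (boundary-pushforward G c (γ v)) ⟩
  boundary G c (γ v)                                                        ∎
  where
  open ≡-Reasoning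
  equivariant : ∀ end → (∀ e → end (α e) ≡ γ (end e)) → pushforward end (c ∘ α) v ≡ pushforward end c (γ v)
  equivariant end end-α = pushforward-equivariant end αα⁻¹ α⁻¹α γγ⁻¹ γ⁻¹γ end-α c v

pathChain : ∀ G {u v} → Star (Adj G) u v → Chain G
pathChain G ε                         = λ _ → 0ℤ
pathChain G ((e , inj₁ _) ◅ path) e′ = ind e e′ + pathChain G path e′
pathChain G ((e , inj₂ _) ◅ path) e′ = - ind e e′ + pathChain G path e′

boundary-pathChain : ∀ G {u v} (path : Star (Adj G) u v) w →
                     boundary G (pathChain G path) w ≡ ind v w - ind u w
boundary-pathChain G {u} ε w =
  trans (boundary-zero G w) (sym (ℤ.+-inverseʳ (ind u w)))
boundary-pathChain G {u} {v} ((e , inj₁ (refl , refl)) ◅ path) w =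
  trans (boundary-+ G (ind e) _ w)
        (trans (cong₂ _+_ (boundary-ind G e w) (boundary-pathChain G path w))
               (telescope (ind v w) (ind (tgt G e) w) (ind (src G e) w)))
  where
  telescope : ∀ a b c → (b - c) + (a - b) ≡ a - c
  telescope = solve-∀
boundary-pathChain G {u} {v} ((e , inj₂ (refl , refl)) ◅ path) w =
  trans (boundary-+ G (λ e′ → - ind e e′) _ w)
        (trans (cong₂ _+_ (trans (boundary-neg G (ind e) w) (cong -_ (boundary-ind G e w)))
                          (boundary-pathChain G path w))
               (telescope (ind v w) (ind (src G e) w) (ind (tgt G e) w)))
  where
  telescope : ∀ a b c → - (c - b) + (a - b) ≡ a - c
  telescope = solve-∀


module Congruence (p : ℕ) where

  -- A record rather than a synonym for a ≡[mod p ] b, so that a and b can be inferred.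
  infix 4 _≈_
  record _≈_ (a b : ℤ) : Set where
    constructor mk≈
    field unmk≈ : a ≡[mod p ] b
  open _≈_ public

  private
    fromSigned : ∀ {a b} → (+ p) Signed.∣ (a - b) → a ≈ b
    fromSigned = mk≈ ∘ Signed.∣⇒∣ᵤ

    toSigned : ∀ {a b} → a ≈ b → (+ p) Signed.∣ (a - b)
    toSigned = Signed.∣ᵤ⇒∣ ∘ unmk≈

    rewrap : ∀ {x a b} → x ≡ a - b → (+ p) Signed.∣ x → a ≈ b
    rewrap eq = fromSigned ∘ subst ((+ p) Signed.∣_) eq

  ≈-refl : ∀ {a} → a ≈ a
  ≈-refl {a} = rewrap (sym (ℤ.+-inverseʳ a)) (Signed.divides 0ℤ refl)

  ≡⇒≈ : ∀ {a b} → a ≡ b → a ≈ b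
  ≡⇒≈ refl = ≈-refl

  ≈-sym : ∀ {a b} → a ≈ b → b ≈ a
  ≈-sym {a} {b} a≈b = rewrap (flip a b) (Signed.∣m⇒∣-m (toSigned a≈b))
    where
    flip : ∀ a b → - (a - b) ≡ b - a
    flip = solve-∀

  ≈-trans : ∀ {a b c} → a ≈ b → b ≈ c → a ≈ c
  ≈-trans {a} {b} {c} a≈b b≈c = rewrap (chain a b c) (Signed.∣m∣n⇒∣m+n (toSigned a≈b) (toSigned b≈c))
    where
    chain : ∀ a b c → (a - b) + (b - c) ≡ a - c
    chain = solve-∀

  ≈-isEquivalence : IsEquivalence _≈_
  ≈-isEquivalence = record { refl = ≈-refl ; sym = ≈-sym ; trans = ≈-trans }

  ≈-setoid : Setoid _ _
  ≈-setoid = record { isEquivalence = ≈-isEquivalence }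

  module ≈-Reasoning = Relation.Binary.Reasoning.Setoid ≈-setoid

  +-cong : ∀ {a b c d} → a ≈ b → c ≈ d → a + c ≈ b + d
  +-cong {a} {b} {c} {d} a≈b c≈d = rewrap (regroup a b c d) (Signed.∣m∣n⇒∣m+n (toSigned a≈b) (toSigned c≈d))
    where
    regroup : ∀ a b c d → (a - b) + (c - d) ≡ (a + c) - (b + d)
    regroup = solve-∀

  +-congˡ : ∀ x {a b} → a ≈ b → x + a ≈ x + b
  +-congˡ x = +-cong (≈-refl {x})

  +-congʳ : ∀ x {a b} → a ≈ b → a + x ≈ b + x
  +-congʳ x a≈b = +-cong a≈b (≈-refl {x})

  -‿cong : ∀ {a b} → a ≈ b → - a ≈ - b
  -‿cong {a} {b} a≈b = rewrap (regroup a b) (Signed.∣m⇒∣-m (toSigned a≈b))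
    where
    regroup : ∀ a b → - (a - b) ≡ - a - - b
    regroup = solve-∀

  sub-cong : ∀ {a b c d} → a ≈ b → c ≈ d → a - c ≈ b - d
  sub-cong a≈b c≈d = +-cong a≈b (-‿cong c≈d)

  sub-congˡ : ∀ x {a b} → a ≈ b → x - a ≈ x - b
  sub-congˡ x a≈b = +-congˡ x (-‿cong a≈b)

  sub-congʳ : ∀ x {a b} → a ≈ b → a - x ≈ b - x
  sub-congʳ x a≈b = +-congʳ (- x) a≈b

  *-congˡ : ∀ c {a b} → a ≈ b → c * a ≈ c * b
  *-congˡ c {a} {b} a≈b = rewrap (distrib c a b) (Signed.∣n⇒∣m*n c (toSigned a≈b))
    where
    distrib : ∀ c a b → c * (a - b) ≡ c * a - c * b
    distrib = solve-∀

  *-congʳ : ∀ c {a b} → a ≈ b → a * c ≈ b * c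
  *-congʳ c {a} {b} a≈b = subst₂ _≈_ (ℤ.*-comm c a) (ℤ.*-comm c b) (*-congˡ c a≈b)

  *p≈0 : ∀ k → k * + p ≈ 0ℤ
  *p≈0 k = rewrap (sym (ℤ.+-identityʳ (k * + p))) (Signed.∣n⇒∣m*n k Signed.∣-refl)

  sumFin-cong≈ : ∀ n {g h : Fin n → ℤ} → (∀ i → g i ≈ h i) → sumFin n g ≈ sumFin n h
  sumFin-cong≈ zero    eq = ≈-refl
  sumFin-cong≈ (suc n) eq = +-cong (eq zero) (sumFin-cong≈ n (eq ∘ suc))

  1≉0 : 1 ℕ.< p → ¬ (1ℤ ≈ 0ℤ)
  1≉0 1<p 1≈0 = ℕ.<⇒≱ 1<p (∣⇒≤ (unmk≈ 1≈0))


-- Binomial coefficients and finite differences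

C-absorption : ∀ n k → suc k ℕ.* (suc n C suc k) ≡ suc n ℕ.* (n C k)
C-absorption zero    zero    = refl
C-absorption zero    (suc k) = trans (cong (suc (suc k) ℕ.*_) (k>n⇒nCk≡0 {1} {suc (suc k)} (s≤s (s≤s z≤n))))
                                     (trans (ℕ.*-zeroʳ (suc (suc k))) (cong (1 ℕ.*_) (sym (k>n⇒nCk≡0 {0} {suc k} (s≤s z≤n)))))
C-absorption (suc n) zero    = trans (ℕ.*-identityˡ _) (trans (nC1≡n (suc (suc n))) (sym (ℕ.*-identityʳ (suc (suc n)))))
C-absorption (suc n) (suc k) = begin
  suc (suc k) ℕ.* (suc (suc n) C suc (suc k))
    ≡⟨ cong (suc (suc k) ℕ.*_) (sym (nCk+nC[k+1]≡[n+1]C[k+1] (suc n) (suc k))) ⟩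
  suc (suc k) ℕ.* (suc n C suc k ℕ.+ suc n C suc (suc k))
    ≡⟨ regroup k (suc n C suc k) (suc n C suc (suc k)) ⟩
  suc k ℕ.* (suc n C suc k) ℕ.+ suc n C suc k ℕ.+ suc (suc k) ℕ.* (suc n C suc (suc k))
    ≡⟨ cong₂ (λ a b → a ℕ.+ suc n C suc k ℕ.+ b) (C-absorption n k) (C-absorption n (suc k)) ⟩
  suc n ℕ.* (n C k) ℕ.+ suc n C suc k ℕ.+ suc n ℕ.* (n C suc k)
    ≡⟨ regroup′ n (n C k) (n C suc k) (suc n C suc k) ⟩
  suc n ℕ.* (n C k ℕ.+ n C suc k) ℕ.+ suc n C suc k
    ≡⟨ cong (λ a → suc n ℕ.* a ℕ.+ suc n C suc k) (nCk+nC[k+1]≡[n+1]C[k+1] n k) ⟩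
  suc n ℕ.* (suc n C suc k) ℕ.+ suc n C suc k
    ≡⟨ ℕ.+-comm (suc n ℕ.* (suc n C suc k)) _ ⟩
  suc (suc n) ℕ.* (suc n C suc k) ∎
  where
  open ≡-Reasoning
  regroup : ∀ k x y → suc (suc k) ℕ.* (x ℕ.+ y) ≡ suc k ℕ.* x ℕ.+ x ℕ.+ suc (suc k) ℕ.* y
  regroup = ℕ-Solver.solve-∀
  regroup′ : ∀ n a b x → suc n ℕ.* a ℕ.+ x ℕ.+ suc n ℕ.* b ≡ suc n ℕ.* (a ℕ.+ b) ℕ.+ x
  regroup′ = ℕ-Solver.solve-∀

prime∣C : ∀ {p k} → Prime p → 0 < k → k < p → p ∣ p C k
prime∣C {suc n} {suc j} p-prime _ k<p
  with euclidsLemma (suc j) (suc n C suc j) p-prime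
         (divides (n C j) (trans (C-absorption n j) (ℕ.*-comm (suc n) (n C j))))
... | inj₁ p∣k = contradiction (∣⇒≤ p∣k) (ℕ.<⇒≱ k<p)
... | inj₂ p∣C = p∣C

-- Through sumFin, sumTo (suc n) f reduces to f 0 + sumTo n (f ∘ suc).
sumTo : ℕ → (ℕ → ℤ) → ℤ
sumTo n f = sumFin n (f ∘ toℕ)

sumTo-snoc : ∀ n f → sumTo (suc n) f ≡ sumTo n f + f n
sumTo-snoc zero    f = trans (ℤ.+-identityʳ (f 0)) (sym (ℤ.+-identityˡ (f 0)))
sumTo-snoc (suc n) f = trans (cong (_+_ (f 0)) (sumTo-snoc n (f ∘ suc))) (sym (ℤ.+-assoc (f 0) _ (f (suc n))))

δ₀ : ℕ → ℤ
δ₀ zero    = 1ℤ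
δ₀ (suc _) = 0ℤ

+suc : ∀ n → + suc n ≡ + n + 1ℤ
+suc n = trans (ℤ.pos-+ 1 n) (ℤ.+-comm 1ℤ (+ n))

sumTo-δ₀ : ∀ n (f : ℕ → ℤ) → sumTo (suc n) (λ j → δ₀ j * f j) ≡ f 0
sumTo-δ₀ n f = begin
  1ℤ * f 0 + sumTo n (λ j → 0ℤ * f (suc j))   ≡⟨ cong₂ _+_ (ℤ.*-identityˡ (f 0)) (sumFin-cong n (λ j → ℤ.*-zeroˡ (f (suc (toℕ j))))) ⟩
  f 0 + sumFin n (λ _ → 0ℤ)                   ≡⟨ cong (_+_ (f 0)) (sumFin-zero n) ⟩
  f 0 + 0ℤ                                    ≡⟨ ℤ.+-identityʳ (f 0) ⟩
  f 0                                         ∎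
  where open ≡-Reasoning

sumTo-rotate : ∀ n (f : ℕ → ℤ) → f n ≡ f 0 → sumTo n (f ∘ suc) ≡ sumTo n f
sumTo-rotate n f periodic = begin
  sumTo n (f ∘ suc)                  ≡⟨ sym (cancel (f 0) _) ⟩
  (f 0 + sumTo n (f ∘ suc)) - f 0    ≡⟨ cong (_- f 0) (sumTo-snoc n f) ⟩
  (sumTo n f + f n) - f 0            ≡⟨ cong (λ t → (sumTo n f + t) - f 0) periodic ⟩
  (sumTo n f + f 0) - f 0            ≡⟨ trans (cong (_- f 0) (ℤ.+-comm (sumTo n f) (f 0))) (cancel (f 0) _) ⟩
  sumTo n f                          ∎
  where
  open ≡-Reasoning
  cancel : ∀ a x → (a + x) - a ≡ x
  cancel = solve-∀

sumTo-telescope : ∀ n (f : ℕ → ℤ) → sumTo n (λ j → f (suc j) - f j) ≡ f n - f 0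
sumTo-telescope zero    f = sym (ℤ.+-inverseʳ (f 0))
sumTo-telescope (suc n) f = trans (cong (_+_ (f 1 - f 0)) (sumTo-telescope n (f ∘ suc))) (telescope (f 0) (f 1) (f (suc n)))
  where
  telescope : ∀ a b c → (b - a) + (c - b) ≡ c - a
  telescope = solve-∀

Δ : (ℕ → ℤ) → ℕ → ℤ
Δ s i = s (suc i) - s i

pascal-sum : ∀ k (a : ℕ → ℤ) →
  sumTo (suc k) (λ j → + (k C j) * a j) + sumTo (suc k) (λ j → + (k C j) * a (suc j))
  ≡ sumTo (suc (suc k)) (λ j → + (suc k C j) * a j)
pascal-sum k a = begin
  (+ 1 * a 0 + U) + L
    ≡⟨ regroup (+ 1 * a 0) U L ⟩
  + 1 * a 0 + (L + (U + 0ℤ))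
    ≡⟨ cong (λ t → + 1 * a 0 + (L + (U + t))) (sym top-vanishes) ⟩
  + 1 * a 0 + (L + (U + + (k C suc k) * a (suc k)))
    ≡⟨ cong (λ t → + 1 * a 0 + (L + t)) (sym (sumTo-snoc k (λ j → + (k C suc j) * a (suc j)))) ⟩
  + 1 * a 0 + (L + sumTo (suc k) (λ j → + (k C suc j) * a (suc j)))
    ≡⟨ cong (_+_ (+ 1 * a 0)) (sym (sumFin-distrib-+ (suc k) ((λ j → + (k C j) * a (suc j)) ∘ toℕ)
                                                            ((λ j → + (k C suc j) * a (suc j)) ∘ toℕ))) ⟩
  + 1 * a 0 + sumTo (suc k) (λ j → + (k C j) * a (suc j) + + (k C suc j) * a (suc j))
    ≡⟨ cong (_+_ (+ 1 * a 0)) (sumFin-cong (suc k) (pascal ∘ toℕ)) ⟩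
  + 1 * a 0 + sumTo (suc k) (λ j → + (suc k C suc j) * a (suc j)) ∎
  where
  open ≡-Reasoning
  U = sumTo k (λ j → + (k C suc j) * a (suc j))
  L = sumTo (suc k) (λ j → + (k C j) * a (suc j))
  regroup : ∀ x u l → (x + u) + l ≡ x + (l + (u + 0ℤ))
  regroup = solve-∀
  top-vanishes : + (k C suc k) * a (suc k) ≡ 0ℤ
  top-vanishes = trans (cong (λ c → + c * a (suc k)) (k>n⇒nCk≡0 (ℕ.n<1+n k))) (ℤ.*-zeroˡ (a (suc k)))
  pascal : ∀ j → + (k C j) * a (suc j) + + (k C suc j) * a (suc j) ≡ + (suc k C suc j) * a (suc j)
  pascal j = begin
    + (k C j) * a (suc j) + + (k C suc j) * a (suc j) ≡⟨ sym (ℤ.*-distribʳ-+ (a (suc j)) (+ (k C j)) (+ (k C suc j))) ⟩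
    (+ (k C j) + + (k C suc j)) * a (suc j)           ≡⟨ cong (_* a (suc j)) (sym (ℤ.pos-+ (k C j) (k C suc j))) ⟩
    + (k C j ℕ.+ k C suc j) * a (suc j)               ≡⟨ cong (λ c → + c * a (suc j)) (nCk+nC[k+1]≡[n+1]C[k+1] k j) ⟩
    + (suc k C suc j) * a (suc j)                     ∎

newton : ∀ k s i → s (k ℕ.+ i) ≡ sumTo (suc k) (λ j → + (k C j) * (Δ ^ j) s i)
newton zero    s i = unit (s i)
  where
  unit : ∀ x → x ≡ + 1 * x + 0ℤ
  unit = solve-∀
newton (suc k) s i = begin
  s (suc k ℕ.+ i)
    ≡⟨ cong s (sym (ℕ.+-suc k i)) ⟩
  s (k ℕ.+ suc i)
    ≡⟨ newton k s (suc i) ⟩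
  sumTo (suc k) (λ j → + (k C j) * (Δ ^ j) s (suc i))
    ≡⟨ sumFin-cong (suc k) (step ∘ toℕ) ⟩
  sumTo (suc k) (λ j → + (k C j) * (Δ ^ j) s i + + (k C j) * (Δ ^ suc j) s i)
    ≡⟨ sumFin-distrib-+ (suc k) ((λ j → + (k C j) * (Δ ^ j) s i) ∘ toℕ) ((λ j → + (k C j) * (Δ ^ suc j) s i) ∘ toℕ) ⟩
  sumTo (suc k) (λ j → + (k C j) * (Δ ^ j) s i) + sumTo (suc k) (λ j → + (k C j) * (Δ ^ suc j) s i)
    ≡⟨ pascal-sum k (λ j → (Δ ^ j) s i) ⟩
  sumTo (suc (suc k)) (λ j → + (suc k C j) * (Δ ^ j) s i) ∎
  where
  open ≡-Reasoning
  split : ∀ c x y → c * y ≡ c * x + c * (y - x)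
  split = solve-∀
  step : ∀ j → + (k C j) * (Δ ^ j) s (suc i) ≡ + (k C j) * (Δ ^ j) s i + + (k C j) * (Δ ^ suc j) s i
  step j = split (+ (k C j)) ((Δ ^ j) s i) ((Δ ^ j) s (suc i))

-- Newton's forward-difference formula for k = p: the middle binomial coefficients
-- vanish mod p, so periodicity leaves only the p-th difference.
periodic⇒Δ^p≈0 : ∀ {p} → Prime p → ∀ s → s p ≡ s 0 → Congruence._≈_ p ((Δ ^ p) s 0) 0ℤ
periodic⇒Δ^p≈0 {suc n} p-prime s periodic = ≈-trans (≡⇒≈ D≡-M) (-‿cong M≈0)
  where
  open Congruence (suc n)
  p = suc n
  M = sumTo n (λ j → + (p C suc j) * (Δ ^ suc j) s 0)
  D = (Δ ^ p) s 0
  expansion : s 0 ≡ + 1 * s 0 + (M + D)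
  expansion = begin
    s 0                                                  ≡⟨ sym periodic ⟩
    s p                                                  ≡⟨ cong s (sym (ℕ.+-identityʳ p)) ⟩
    s (p ℕ.+ 0)                                          ≡⟨ newton p s 0 ⟩
    + 1 * s 0 + sumTo p (λ j → + (p C suc j) * (Δ ^ suc j) s 0)
                                                         ≡⟨ cong (_+_ (+ 1 * s 0)) (sumTo-snoc n (λ j → + (p C suc j) * (Δ ^ suc j) s 0)) ⟩
    + 1 * s 0 + (M + + (p C p) * D)                      ≡⟨ cong (λ c → + 1 * s 0 + (M + + c * D)) (nCn≡1 p) ⟩
    + 1 * s 0 + (M + + 1 * D)                            ≡⟨ cong (λ t → + 1 * s 0 + (M + t)) (ℤ.*-identityˡ D) ⟩
    + 1 * s 0 + (M + D)                                  ∎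
    where open ≡-Reasoning
  D≡-M : D ≡ - M
  D≡-M = trans (sym (solve (s 0) M D)) (trans (cong (λ t → t - s 0 - M) (sym expansion)) (cancel (s 0) M))
    where
    solve : ∀ x m d → (+ 1 * x + (m + d)) - x - m ≡ d
    solve = solve-∀
    cancel : ∀ x m → x - x - m ≡ - m
    cancel = solve-∀
  M≈0 : M ≈ 0ℤ
  M≈0 = ≈-trans (sumFin-cong≈ n (λ j → multiple (toℕ j) (Fin.toℕ<n j))) (≡⇒≈ (sumFin-zero n))
    where
    multiple : ∀ j → j < n → + (p C suc j) * (Δ ^ suc j) s 0 ≈ 0ℤ
    multiple j j<n with prime∣C p-prime (s≤s z≤n) (s≤s j<n)
    ... | divides q C≡q*p = ≈-trans (≡⇒≈ (trans (cong (λ c → + c * (Δ ^ suc j) s 0) C≡q*p)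
                                        (trans (cong (_* (Δ ^ suc j) s 0) (ℤ.pos-* q p))
                                               (reorder (+ q) (+ p) ((Δ ^ suc j) s 0)))))
                                    (*p≈0 ((Δ ^ suc j) s 0 * + q))
      where
      reorder : ∀ q p x → (q * p) * x ≡ (x * q) * p
      reorder = solve-∀



-- Connected components

module _ {n} (f : (Fin n → Bool) → Fin n → Bool) (inflationary : ∀ R w → R w ≡ true → f R w ≡ true) where

  iterate-mono : ∀ R {i j} → i ℕ.≤′ j → ∀ w → (f ^ i) R w ≡ true → (f ^ j) R w ≡ true
  iterate-mono R ℕ.≤′-refl         w = λ i∈ → i∈
  iterate-mono R (ℕ.≤′-step i≤′j) w = inflationary _ w ∘ iterate-mono R i≤′j w

  Stable : (Fin n → Bool) → Set
  Stable R = ∀ w → f R w ≡ R w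

  fresh : ∀ R → ¬ Stable R → Σ (Fin n) λ w → R w ≡ false × f R w ≡ true
  fresh R unstable with Fin.¬∀⟶∃¬ n _ (λ w → f R w Bool.≟ R w) unstable
  ... | w , changed with R w in Rw
  ...   | true  = contradiction (inflationary R w Rw) changed
  ...   | false = w , Rw , Bool.¬-not changed

  -- A chain that grows at each of the first n + 1 steps would contain n + 1 distinct elements.
  stabilises : ∀ R → Σ ℕ λ k → Stable ((f ^ k) R)
  stabilises R with Fin.any? (λ (k : Fin (suc n)) → Fin.all? (λ w → f ((f ^ toℕ k) R) w Bool.≟ (f ^ toℕ k) R w))
  ... | yes (k , stable) = toℕ k , stable
  ... | no unstable      = ⊥-elim (collision (Fin.pigeonhole (ℕ.n<1+n n) (proj₁ ∘ new)))
    where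
    new : ∀ (k : Fin (suc n)) → Σ (Fin n) λ w → (f ^ toℕ k) R w ≡ false × (f ^ suc (toℕ k)) R w ≡ true
    new k = fresh ((f ^ toℕ k) R) (λ stable → unstable (k , stable))
    collision : (∃₂ λ i j → toℕ i < toℕ j × proj₁ (new i) ≡ proj₁ (new j)) → ⊥
    collision (i , j , i<j , same) = contradiction (trans (sym present) (trans (cong ((f ^ toℕ j) R) same) absent)) λ ()
      where
      present = iterate-mono R (ℕ.≤⇒≤′ i<j) (proj₁ (new i)) (proj₂ (proj₂ (new i)))
      absent  = proj₁ (proj₂ (new j))

module Reachability (G : Graph) (u : V G) where

  Incident : (V G → Bool) → V G → E G → Set
  Incident R w e = (R (src G e) ≡ true × tgt G e ≡ w) ⊎ (R (tgt G e) ≡ true × src G e ≡ w)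

  incident? : ∀ R w e → Dec (Incident R w e)
  incident? R w e = (R (src G e) Bool.≟ true ×-dec tgt G e ≟ w) ⊎-dec (R (tgt G e) Bool.≟ true ×-dec src G e ≟ w)

  grow : (V G → Bool) → V G → Bool
  grow R w = R w ∨ does (Fin.any? (incident? R w))

  grow-inflationary : ∀ R w → R w ≡ true → grow R w ≡ true
  grow-inflationary R w Rw = cong (_∨ does (Fin.any? (incident? R w))) Rw

  Reachable : (V G → Bool) → Set
  Reachable R = ∀ w → R w ≡ true → Star (Adj G) u w

  grow-reachable : ∀ R → Reachable R → Reachable (grow R)
  grow-reachable R reachable w grown with R w in Rw | Fin.any? (incident? R w)
  ... | true  | _                             = reachable w Rw
  ... | false | yes (e , inj₁ (Rs , refl)) = reachable (src G e) Rs ◅◅ ((e , inj₁ (refl , refl)) ◅ ε)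
  ... | false | yes (e , inj₂ (Rt , refl)) = reachable (tgt G e) Rt ◅◅ ((e , inj₂ (refl , refl)) ◅ ε)

  grow-incident : ∀ R w → ∃ (Incident R w) → grow R w ≡ true
  grow-incident R w inc with R w | Fin.any? (incident? R w)
  ... | true  | _       = refl
  ... | false | yes _   = refl
  ... | false | no ¬inc = contradiction inc ¬inc

  stable⇒closed : ∀ R → (∀ w → grow R w ≡ R w) → ∀ e → R (src G e) ≡ R (tgt G e)
  stable⇒closed R stable e with R (src G e) in Rs | R (tgt G e) in Rt
  ... | true  | true  = refl
  ... | false | false = refl
  ... | true  | false = contradiction (trans (sym Rt) (trans (sym (stable _)) (grow-incident R _ (e , inj₁ (Rs , refl))))) λ ()
  ... | false | true  = contradiction (trans (sym Rs) (trans (sym (stable _)) (grow-incident R _ (e , inj₂ (Rt , refl))))) λ ()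

  start : V G → Bool
  start w = does (u ≟ w)

  start-reachable : Reachable start
  start-reachable w _ with u ≟ w
  ... | yes refl = ε

  iterate-reachable : ∀ k → Reachable ((grow ^ k) start)
  iterate-reachable zero    = start-reachable
  iterate-reachable (suc k) = grow-reachable _ (iterate-reachable k)

  private
    stable = stabilises grow grow-inflationary start

  component : V G → Bool
  component = (grow ^ proj₁ stable) start

  component-reachable : Reachable component
  component-reachable = iterate-reachable (proj₁ stable)

  component-closed : ∀ e → component (src G e) ≡ component (tgt G e)
  component-closed = stable⇒closed component (proj₂ stable)

  component-base : component u ≡ true
  component-base = iterate-mono grow grow-inflationary start {j = proj₁ stable} ℕ.z≤′n u (start-u (u ≟ u))
    where
    start-u : (d : Dec (u ≡ u)) → does d ≡ true
    start-u (yes _)  = refl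
    start-u (no u≢u) = contradiction refl u≢u


module Connectivity (p : ℕ) where

  open Congruence p

  zero-sum⇒boundary : ∀ G → Connected G → V G → ∀ (u : V G → ℤ) → sumFin (nV G) u ≈ 0ℤ →
                      Σ (Chain G) λ b → ∀ w → boundary G b w ≈ u w
  zero-sum⇒boundary G connected v₀ u Σu≈0 = b , ∂b≈u
    where
    γ : V G → Chain G
    γ v = pathChain G (connected v₀ v)
    b : Chain G
    b e = sumFin (nV G) (λ v → u v * γ v e)
    ∂b≈u : ∀ w → boundary G b w ≈ u w
    ∂b≈u w = begin
      boundary G b w
        ≡⟨ boundary-lincomb G (nV G) u γ w ⟩
      sumFin (nV G) (λ v → u v * boundary G (γ v) w)
        ≡⟨ sumFin-cong (nV G) (λ v → cong (u v *_) (boundary-pathChain G (connected v₀ v) w)) ⟩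
      sumFin (nV G) (λ v → u v * (ind v w - ind v₀ w))
        ≡⟨ sumFin-cong (nV G) (λ v → x[y-z]≈xy-xz (u v) (ind v w) (ind v₀ w)) ⟩
      sumFin (nV G) (λ v → u v * ind v w - u v * ind v₀ w)
        ≡⟨ sumFin-- (nV G) (λ v → u v * ind v w) (λ v → u v * ind v₀ w) ⟩
      sumFin (nV G) (λ v → u v * ind v w) - sumFin (nV G) (λ v → u v * ind v₀ w)
        ≡⟨ cong₂ _-_ (sumFin-ind′ (nV G) w u) (sym (*-distribʳ-sumFin (nV G) (ind v₀ w) u)) ⟩
      u w - sumFin (nV G) u * ind v₀ w
        ≈⟨ sub-congˡ (u w) (*-congʳ (ind v₀ w) Σu≈0) ⟩
      u w - 0ℤ * ind v₀ w
        ≡⟨ cong (λ t → u w - t) (ℤ.*-zeroˡ (ind v₀ w)) ⟩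
      u w - 0ℤ
        ≡⟨ ℤ.+-identityʳ (u w) ⟩
      u w ∎
      where open ≈-Reasoning

  -- Pair the boundary with the indicator χ of the component of u, which is closed under
  -- edges: the pairing vanishes, but on ind v - ind u it gives χ v - 1.
  boundary⇒path : 1 ℕ.< p → ∀ G u v (a : Chain G) → (∀ w → boundary G a w ≈ ind v w - ind u w) → Star (Adj G) u v
  boundary⇒path 1<p G u v a ∂a≈v-u = in-component (component v) refl
    where
    open Reachability G u
    indicator : Bool → ℤ
    indicator b = if b then 1ℤ else 0ℤ
    χ : V G → ℤ
    χ w = indicator (component w)
    pair-with-boundary : sumFin (nV G) (λ w → boundary G a w * χ w) ≡ 0ℤ
    pair-with-boundary = trans (boundary-pairing G a χ)
      (trans (sumFin-cong (nE G) (λ e → trans (cong (λ t → a e * (χ (tgt G e) - t)) (cong indicator (component-closed e)))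
                                              (trans (cong (a e *_) (ℤ.+-inverseʳ (χ (tgt G e)))) (ℤ.*-zeroʳ (a e)))))
             (sumFin-zero (nE G)))
    χv-1≈0 : χ v - 1ℤ ≈ 0ℤ
    χv-1≈0 = begin
      χ v - 1ℤ                                        ≡⟨ cong (_-_ (χ v)) (sym (cong indicator component-base)) ⟩
      χ v - χ u                                       ≡⟨ sym (sumFin-ind-difference (nV G) u v χ) ⟩
      sumFin (nV G) (λ w → (ind v w - ind u w) * χ w) ≈⟨ sumFin-cong≈ (nV G) (λ w → *-congʳ (χ w) (≈-sym (∂a≈v-u w))) ⟩
      sumFin (nV G) (λ w → boundary G a w * χ w)      ≡⟨ pair-with-boundary ⟩
      0ℤ                                              ∎
      where open ≈-Reasoning
    in-component : ∀ b → component v ≡ b → Star (Adj G) u v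
    in-component true  v∈ = component-reachable v v∈
    in-component false v∉ = ⊥-elim (1≉0 1<p (-‿cong (subst (λ t → t - 1ℤ ≈ 0ℤ) (cong indicator v∉) χv-1≈0)))


-- Orbits of periodic maps

argmin : ∀ r (f : ℕ → ℕ) → 0 < r → Σ ℕ λ k → k < r × (∀ j → j < r → f k ≤ f j)
argmin (suc zero)    f _ = 0 , s≤s z≤n , λ { zero _ → ℕ.≤-refl ; (suc j) (s≤s ()) }
argmin (suc (suc r)) f _ with argmin (suc r) f (s≤s z≤n)
... | k , k<r , min with f k ℕ.≤? f (suc r)
...   | yes fk≤ = k , ℕ.m<n⇒m<1+n k<r , new-min
  where
  new-min : ∀ j → j < suc (suc r) → f k ≤ f j
  new-min j j< with ℕ.m<1+n⇒m<n∨m≡n j<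
  ... | inj₁ j<r  = min j j<r
  ... | inj₂ refl = fk≤
...   | no fk≰ = suc r , ℕ.≤-refl , new-min
  where
  new-min : ∀ j → j < suc (suc r) → f (suc r) ≤ f j
  new-min j j< with ℕ.m<1+n⇒m<n∨m≡n j<
  ... | inj₁ j<r  = ℕ.≤-trans (ℕ.<⇒≤ (ℕ.≰⇒> fk≰)) (min j j<r)
  ... | inj₂ refl = ℕ.≤-refl

minimal : ∀ {P : ℕ → Set} → (∀ n → Dec (P n)) → ∀ {n} → P n → Σ ℕ λ m → P m × (∀ {k} → k < m → ¬ P k)
minimal {P} P? {n} = <-rec (λ n → P n → Σ ℕ λ m → P m × (∀ {k} → k < m → ¬ P k)) search n
  where
  search : ∀ n → (∀ {k} → k < n → P k → Σ ℕ λ m → P m × (∀ {k} → k < m → ¬ P k)) → P n → _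
  search n smaller Pn with ℕ.anyUpTo? P? n
  ... | yes (k , k<n , Pk) = smaller k<n Pk
  ... | no none            = n , Pn , λ k<n Pk → none (_ , k<n , Pk)

module Periodic {A : Set} (τ : A → A) (m : ℕ) .{{_ : NonZero m}} (period : ∀ x → (τ ^ m) x ≡ x) where

  τ^-multiple : ∀ q x → (τ ^ (q ℕ.* m)) x ≡ x
  τ^-multiple zero    x = refl
  τ^-multiple (suc q) x = trans (^-+ τ m (q ℕ.* m) x) (trans (cong (τ ^ m) (τ^-multiple q x)) (period x))

  τ^-mod : ∀ a x → (τ ^ a) x ≡ (τ ^ (a % m)) x
  τ^-mod a x = begin
    (τ ^ a) x                                  ≡⟨ cong (λ n → (τ ^ n) x) (m≡m%n+[m/n]*n a m) ⟩
    (τ ^ (a % m ℕ.+ (a / m) ℕ.* m)) x          ≡⟨ ^-+ τ (a % m) ((a / m) ℕ.* m) x ⟩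
    (τ ^ (a % m)) ((τ ^ ((a / m) ℕ.* m)) x)    ≡⟨ cong (τ ^ (a % m)) (τ^-multiple (a / m) x) ⟩
    (τ ^ (a % m)) x                            ∎
    where open ≡-Reasoning

  τ^-∘ : ∀ j k x → (τ ^ j) ((τ ^ k) x) ≡ (τ ^ ((j ℕ.+ k) % m)) x
  τ^-∘ j k x = trans (sym (^-+ τ j k x)) (τ^-mod (j ℕ.+ k) x)

  connecting : ∀ a b x → a < m → Σ ℕ λ j → j < m × (τ ^ j) ((τ ^ a) x) ≡ (τ ^ b) x
  connecting a b x a<m = (b ℕ.+ (m ℕ.∸ a)) % m , m%n<n _ m , (begin
    (τ ^ ((b ℕ.+ (m ℕ.∸ a)) % m)) ((τ ^ a) x)   ≡⟨ sym (τ^-mod (b ℕ.+ (m ℕ.∸ a)) _) ⟩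
    (τ ^ (b ℕ.+ (m ℕ.∸ a))) ((τ ^ a) x)         ≡⟨ sym (^-+ τ (b ℕ.+ (m ℕ.∸ a)) a x) ⟩
    (τ ^ (b ℕ.+ (m ℕ.∸ a) ℕ.+ a)) x             ≡⟨ cong (λ n → (τ ^ n) x) b+m-a+a≡b+m ⟩
    (τ ^ (b ℕ.+ m)) x                           ≡⟨ ^-+ τ b m x ⟩
    (τ ^ b) ((τ ^ m) x)                         ≡⟨ cong (τ ^ b) (period x) ⟩
    (τ ^ b) x                                   ∎)
    where
    open ≡-Reasoning
    b+m-a+a≡b+m : b ℕ.+ (m ℕ.∸ a) ℕ.+ a ≡ b ℕ.+ m
    b+m-a+a≡b+m = trans (ℕ.+-assoc b (m ℕ.∸ a) a) (cong (b ℕ.+_) (ℕ.m∸n+n≡m (ℕ.<⇒≤ a<m)))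

  Free : Set
  Free = ∀ x j → 0 < j → j < m → (τ ^ j) x ≢ x

  exponent-unique : Free → ∀ x {a b} → a < m → b < m → (τ ^ a) x ≡ (τ ^ b) x → a ≡ b
  exponent-unique free x {a} {b} a<m b<m τᵃ≡τᵇ with ℕ.<-cmp a b
  ... | tri≈ _ a≡b _ = a≡b
  ... | tri< a<b _ _ = contradiction (trans (^-∸ τ x (ℕ.<⇒≤ a<b)) (sym τᵃ≡τᵇ))
                                     (free _ (b ℕ.∸ a) (ℕ.m<n⇒0<n∸m a<b) (ℕ.≤-<-trans (ℕ.m∸n≤m b a) b<m))
  ... | tri> _ _ b<a = contradiction (trans (^-∸ τ x (ℕ.<⇒≤ b<a)) τᵃ≡τᵇ)
                                     (free _ (a ℕ.∸ b) (ℕ.m<n⇒0<n∸m b<a) (ℕ.≤-<-trans (ℕ.m∸n≤m a b) a<m))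

-- Each orbit of a free action of ℤ/m on Fin s has exactly one element that is least
-- (as a number) in its orbit; summing the indicator of those over each orbit and
-- over all of Fin s gives s = m · #orbits.
module OrbitCounting {s} (τ : Fin s → Fin s) (m : ℕ) .{{_ : NonZero m}}
                     (period : ∀ x → (τ ^ m) x ≡ x) (free : Periodic.Free τ m period) where

  open Periodic τ m period

  IsMin : Fin s → Set
  IsMin x = ∀ {j} → j < m → toℕ x ≤ toℕ ((τ ^ j) x)

  min-in-orbit : ∀ x → Σ ℕ λ k → k < m × IsMin ((τ ^ k) x)
  min-in-orbit x with argmin m (λ j → toℕ ((τ ^ j) x)) (ℕ.>-nonZero⁻¹ m)
  ... | k , k<m , min = k , k<m , λ {j} _ →
    subst (λ y → toℕ ((τ ^ k) x) ≤ toℕ y) (sym (τ^-∘ j k x)) (min _ (m%n<n (j ℕ.+ k) m))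

  min-unique : ∀ x {a b} → a < m → b < m → IsMin ((τ ^ a) x) → IsMin ((τ ^ b) x) → a ≡ b
  min-unique x {a} {b} a<m b<m a-min b-min =
    exponent-unique free x a<m b<m (Fin.toℕ-injective (ℕ.≤-antisym (below a-min b a<m) (below b-min a b<m)))
    where
    below : ∀ {a} → IsMin ((τ ^ a) x) → ∀ b → a < m → toℕ ((τ ^ a) x) ≤ toℕ ((τ ^ b) x)
    below {a} a-min b a<m with connecting a b x a<m
    ... | j , j<m , τʲτᵃ≡τᵇ = subst (λ y → toℕ ((τ ^ a) x) ≤ toℕ y) τʲτᵃ≡τᵇ (a-min j<m)

  isMin : Fin s → ℤ
  isMin x = if does (ℕ.allUpTo? (λ j → toℕ x ℕ.≤? toℕ ((τ ^ j) x)) m) then 1ℤ else 0ℤ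

  orbit-isMin : ∀ x → sumTo m (λ j → isMin ((τ ^ j) x)) ≡ 1ℤ
  orbit-isMin x with min-in-orbit x
  ... | k , k<m , k-min = trans (sumFin-cong m (λ j → trans (one-at j) (sym (ℤ.*-identityʳ _))))
                                (sumFin-ind m (fromℕ< k<m) (λ _ → 1ℤ))
    where
    one-at : ∀ j → isMin ((τ ^ toℕ j) x) ≡ ind (fromℕ< k<m) j
    one-at j with ℕ.allUpTo? (λ i → toℕ ((τ ^ toℕ j) x) ℕ.≤? toℕ ((τ ^ i) ((τ ^ toℕ j) x))) m
    ... | yes j-min = sym (trans (cong (λ i → ind i j) k≡j) (ind-diag j))
      where
      k≡j : fromℕ< k<m ≡ j
      k≡j = Fin.toℕ-injective (trans (Fin.toℕ-fromℕ< k<m) (min-unique x k<m (Fin.toℕ<n j) k-min j-min))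
    ... | no ¬j-min = sym (ind-≢ λ k≡j → ¬j-min (subst (λ i → IsMin ((τ ^ i) x)) (trans (sym (Fin.toℕ-fromℕ< k<m)) (cong toℕ k≡j)) k-min))

  τ⁻¹ : Fin s → Fin s
  τ⁻¹ = τ ^ ℕ.pred m

  sumFin-invariant : ∀ j (h : Fin s → ℤ) → sumFin s (h ∘ (τ ^ j)) ≡ sumFin s h
  sumFin-invariant zero    h = refl
  sumFin-invariant (suc j) h = trans (sumFin-invariant j (h ∘ τ)) (sumFin-reindex s ττ⁻¹ τ⁻¹τ h)
    where
    ττ⁻¹ : ∀ x → τ (τ⁻¹ x) ≡ x
    ττ⁻¹ x = trans (cong (λ n → (τ ^ n) x) (ℕ.suc-pred m)) (period x)
    τ⁻¹τ : ∀ x → τ⁻¹ (τ x) ≡ x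
    τ⁻¹τ x = trans (sym (^-suc τ (ℕ.pred m) x)) (ττ⁻¹ x)

  orbits-divide : m ∣ s
  orbits-divide = divides ∣ orbits ∣ (trans (cong ∣_∣ (trans s≡m*orbits (ℤ.*-comm (+ m) orbits))) (ℤ.abs-* orbits (+ m)))
    where
    orbits = sumFin s isMin
    s≡m*orbits : + s ≡ + m * orbits
    s≡m*orbits = begin
      + s                                                 ≡⟨ trans (sym (ℤ.*-identityʳ (+ s))) (sym (sumFin-const s 1ℤ)) ⟩
      sumFin s (λ _ → 1ℤ)                                 ≡⟨ sumFin-cong s (λ x → sym (orbit-isMin x)) ⟩
      sumFin s (λ x → sumTo m (λ j → isMin ((τ ^ j) x)))  ≡⟨ sumFin-comm s m _ ⟩
      sumTo m (λ j → sumFin s (isMin ∘ (τ ^ j)))          ≡⟨ sumFin-cong m (λ j → sumFin-invariant (toℕ j) isMin) ⟩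
      sumTo m (λ _ → orbits)                              ≡⟨ sumFin-const m orbits ⟩
      + m * orbits                                        ∎
      where open ≡-Reasoning

-- Unique lifting along immersions

idʰ : ∀ {Y} → Hom Y Y
idʰ = record { vmap = λ v → v ; emap = λ e → e ; src-hom = λ _ → refl ; tgt-hom = λ _ → refl }

infixr 8 _^ʰ_
_^ʰ_ : ∀ {Y} → Hom Y Y → ℕ → Hom Y Y
_^ʰ_ {Y} d k = record { vmap = vmap d ^ k ; emap = emap d ^ k ; src-hom = end-hom src (src-hom d) k ; tgt-hom = end-hom tgt (tgt-hom d) k }
  where
  end-hom : ∀ end → (∀ e → end Y (emap d e) ≡ vmap d (end Y e)) → ∀ k e → end Y ((emap d ^ k) e) ≡ (vmap d ^ k) (end Y e)
  end-hom end hom zero    e = refl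
  end-hom end hom (suc k) e = trans (hom _) (cong (vmap d) (end-hom end hom k e))

module UniqueLifting {Y X : Graph} (c : Hom Y X) (c-immersion : Immersion c) {Z : Graph} (F G : Hom Z Y)
                     (same-image : ∀ e → emap c (emap F e) ≡ emap c (emap G e)) where

  agree-at-src : ∀ e → vmap F (src Z e) ≡ vmap G (src Z e) → emap F e ≡ emap G e
  agree-at-src e same = proj₁ c-immersion _ _ (same-image e) (trans (src-hom F e) (trans same (sym (src-hom G e))))

  agree-at-tgt : ∀ e → vmap F (tgt Z e) ≡ vmap G (tgt Z e) → emap F e ≡ emap G e
  agree-at-tgt e same = proj₂ c-immersion _ _ (same-image e) (trans (tgt-hom F e) (trans same (sym (tgt-hom G e))))

  propagate : ∀ {z z′} → Star (Adj Z) z z′ → vmap F z ≡ vmap G z → vmap F z′ ≡ vmap G z′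
  propagate ε same = same
  propagate ((e , inj₁ (refl , refl)) ◅ path) same =
    propagate path (trans (sym (tgt-hom F e)) (trans (cong (tgt Y) (agree-at-src e same)) (tgt-hom G e)))
  propagate ((e , inj₂ (refl , refl)) ◅ path) same =
    propagate path (trans (sym (src-hom F e)) (trans (cong (src Y) (agree-at-tgt e same)) (src-hom G e)))

  module _ (connected : Connected Z) (z : V Z) (same : vmap F z ≡ vmap G z) where

    vertices-agree : ∀ z′ → vmap F z′ ≡ vmap G z′
    vertices-agree z′ = propagate (connected z z′) same

    edges-agree : ∀ e → emap F e ≡ emap G e
    edges-agree e = agree-at-src e (vertices-agree (src Z e))


module ZpChains (p-1 : ℕ) (p-prime : Prime (suc p-1)) where

  p : ℕ
  p = suc p-1

  open Congruence p public

  Ch : Set → Set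
  Ch A = A → ℤ

  infix 4 _≋_
  _≋_ : ∀ {A} → Ch A → Ch A → Set
  f ≋ g = ∀ i → f i ≈ g i

  0ᶜ : ∀ {A} → Ch A
  0ᶜ _ = 0ℤ

  infixl 6 _+ᶜ_ _-ᶜ_
  _+ᶜ_ _-ᶜ_ : ∀ {A} → Ch A → Ch A → Ch A
  (f +ᶜ g) i = f i + g i
  (f -ᶜ g) i = f i - g i

  record Linear {A B : Set} (F : Ch A → Ch B) : Set where
    field
      ≋-cong : ∀ {a b} → a ≋ b → F a ≋ F b
      +-hom  : ∀ a b → F (a +ᶜ b) ≋ F a +ᶜ F b

    0-hom : F 0ᶜ ≋ 0ᶜ
    0-hom k = begin
      F 0ᶜ k                      ≈⟨ ≡⇒≈ (sym (ℤ.+-identityʳ _)) ⟩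
      F 0ᶜ k + 0ℤ                 ≈⟨ +-congˡ (F 0ᶜ k) (≡⇒≈ (sym (ℤ.+-inverseʳ (F 0ᶜ k)))) ⟩
      F 0ᶜ k + (F 0ᶜ k - F 0ᶜ k)  ≈⟨ ≡⇒≈ (sym (ℤ.+-assoc (F 0ᶜ k) (F 0ᶜ k) _)) ⟩
      F 0ᶜ k + F 0ᶜ k - F 0ᶜ k    ≈⟨ +-congʳ (- F 0ᶜ k) (≈-sym (+-hom 0ᶜ 0ᶜ k)) ⟩
      F 0ᶜ k - F 0ᶜ k             ≈⟨ ≡⇒≈ (ℤ.+-inverseʳ (F 0ᶜ k)) ⟩
      0ℤ                          ∎
      where open ≈-Reasoning

    -‿hom : ∀ a → F (λ i → - a i) ≋ λ k → - F a k
    -‿hom a k = begin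
      F (λ i → - a i) k                              ≈⟨ ≡⇒≈ (sym (ℤ.+-identityˡ _)) ⟩
      0ℤ + F (λ i → - a i) k                         ≈⟨ +-congʳ (F (λ i → - a i) k) (≡⇒≈ (sym (ℤ.+-inverseˡ (F a k)))) ⟩
      - F a k + F a k + F (λ i → - a i) k            ≈⟨ ≡⇒≈ (ℤ.+-assoc (- F a k) (F a k) _) ⟩
      - F a k + (F a k + F (λ i → - a i) k)          ≈⟨ +-congˡ (- F a k) (≈-sym (+-hom a (λ i → - a i) k)) ⟩
      - F a k + F (λ i → a i + - a i) k              ≈⟨ +-congˡ (- F a k) (≋-cong (λ i → ≡⇒≈ (ℤ.+-inverseʳ (a i))) k) ⟩
      - F a k + F 0ᶜ k                               ≈⟨ +-congˡ (- F a k) (0-hom k) ⟩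
      - F a k + 0ℤ                                   ≈⟨ ≡⇒≈ (ℤ.+-identityʳ _) ⟩
      - F a k                                        ∎
      where open ≈-Reasoning

    -hom : ∀ a b → F (a -ᶜ b) ≋ F a -ᶜ F b
    -hom a b k = ≈-trans (+-hom a (λ i → - b i) k) (+-congˡ (F a k) (-‿hom b k))

    sumTo-hom : ∀ m (a : ℕ → Ch A) → F (λ i → sumTo m (λ j → a j i)) ≋ λ k → sumTo m (λ j → F (a j) k)
    sumTo-hom zero    a = 0-hom
    sumTo-hom (suc m) a k = ≈-trans (+-hom (a 0) (λ i → sumTo m (λ j → a (suc j) i)) k)
                                    (+-congˡ (F (a 0) k) (sumTo-hom m (a ∘ suc) k))

  ∘-linear : ∀ {A B C} {F : Ch B → Ch C} {G : Ch A → Ch B} → Linear F → Linear G → Linear (F ∘ G)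
  ∘-linear {G = G} LF LG = record
    { ≋-cong = LF.≋-cong ∘ LG.≋-cong
    ; +-hom  = λ a b k → ≈-trans (LF.≋-cong (LG.+-hom a b) k) (LF.+-hom (G a) (G b) k) }
    where
    module LF = Linear LF
    module LG = Linear LG

  ^-linear : ∀ {A} {F : Ch A → Ch A} → Linear F → ∀ k → Linear (F ^ k)
  ^-linear LF zero    = record { ≋-cong = λ a≋b → a≋b ; +-hom = λ _ _ _ → ≈-refl }
  ^-linear LF (suc k) = ∘-linear LF (^-linear LF k)

  -- σ generates a free action of ℤ/p on Tot with quotient map proj; section picks a point of
  -- each orbit and v = σ^(coord v) (section (proj v)).  On chains, N = σ* − 1, T = Σⱼ (σʲ)* is
  -- the norm and π (sum over fibres) the coinvariant map of the 𝔽_p[ℤ/p]-module Ch Tot.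
  record FreeZpSet (Tot Base : Set) : Set where
    field
      proj         : Tot → Base
      σ            : Tot → Tot
      section      : Base → Tot
      coord        : Tot → ℕ
      coord<p      : ∀ v → coord v < p
      proj-σ       : ∀ v → proj (σ v) ≡ proj v
      proj-section : ∀ x → proj (section x) ≡ x
      σ^coord      : ∀ v → (σ ^ coord v) (section (proj v)) ≡ v
      coord-σ^     : ∀ x j → j < p → coord ((σ ^ j) (section x)) ≡ j
      σ^p          : ∀ v → (σ ^ p) v ≡ v

    proj-σ^ : ∀ j v → proj ((σ ^ j) v) ≡ proj v
    proj-σ^ zero    v = refl
    proj-σ^ (suc j) v = trans (proj-σ _) (proj-σ^ j v)

    σ⁻¹ : Tot → Tot
    σ⁻¹ = σ ^ p-1

    σσ⁻¹ : ∀ v → σ (σ⁻¹ v) ≡ v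
    σσ⁻¹ = σ^p

    σ⁻¹σ : ∀ v → σ⁻¹ (σ v) ≡ v
    σ⁻¹σ v = trans (sym (^-suc σ p-1 v)) (σ^p v)

    N : Ch Tot → Ch Tot
    N c v = c (σ v) - c v

    T : Ch Tot → Ch Tot
    T c v = sumTo p (λ j → c ((σ ^ j) v))

    π : Ch Tot → Ch Base
    π c x = T c (section x)

    lift : Ch Base → Ch Tot
    lift a v = δ₀ (coord v) * a (proj v)

    T-σ : ∀ c v → T c (σ v) ≡ T c v
    T-σ c v = trans (sumFin-cong p (λ j → cong c (sym (^-suc σ (toℕ j) v))))
                    (sumTo-rotate p (λ j → c ((σ ^ j) v)) (cong c (σ^p v)))

    T-σ^ : ∀ c k v → T c ((σ ^ k) v) ≡ T c v
    T-σ^ c zero    v = refl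
    T-σ^ c (suc k) v = trans (T-σ c ((σ ^ k) v)) (T-σ^ c k v)

    N∘T≋0 : ∀ c → N (T c) ≋ 0ᶜ
    N∘T≋0 c v = ≡⇒≈ (trans (cong (_- T c v) (T-σ c v)) (ℤ.+-inverseʳ (T c v)))

    T∘N≋0 : ∀ c → T (N c) ≋ 0ᶜ
    T∘N≋0 c v = ≡⇒≈ (trans (sumTo-telescope p (λ j → c ((σ ^ j) v)))
                           (trans (cong (λ w → c w - c v) (σ^p v)) (ℤ.+-inverseʳ (c v))))

    T-lift : ∀ a v → T (lift a) v ≡ a (proj v)
    T-lift a v = begin
      T (lift a) v                                    ≡⟨ cong (T (lift a)) (sym (σ^coord v)) ⟩
      T (lift a) ((σ ^ coord v) (section x))          ≡⟨ T-σ^ (lift a) (coord v) (section x) ⟩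
      T (lift a) (section x)                          ≡⟨ sumFin-cong p (λ j → on-orbit (toℕ j) (Fin.toℕ<n j)) ⟩
      sumTo p (λ j → δ₀ j * a x)                      ≡⟨ sumTo-δ₀ p-1 (λ _ → a x) ⟩
      a x                                             ∎
      where
      open ≡-Reasoning
      x = proj v
      on-orbit : ∀ j → j < p → lift a ((σ ^ j) (section x)) ≡ δ₀ j * a x
      on-orbit j j<p = cong₂ (λ i y → δ₀ i * a y) (coord-σ^ x j j<p) (trans (proj-σ^ j (section x)) (proj-section x))

    π-lift : ∀ a x → π (lift a) x ≡ a x
    π-lift a x = trans (T-lift a (section x)) (cong a (proj-section x))

    N-linear : Linear N
    N-linear = record
      { ≋-cong = λ a≋b v → sub-cong (a≋b (σ v)) (a≋b v)
      ; +-hom  = λ a b v → ≡⇒≈ (regroup (a (σ v)) (b (σ v)) (a v) (b v)) }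
      where
      regroup : ∀ x y z w → (x + y) - (z + w) ≡ (x - z) + (y - w)
      regroup = solve-∀

    T-linear : Linear T
    T-linear = record
      { ≋-cong = λ a≋b v → sumFin-cong≈ p (λ j → a≋b ((σ ^ toℕ j) v))
      ; +-hom  = λ a b v → ≡⇒≈ (sumFin-distrib-+ p (λ j → a ((σ ^ toℕ j) v)) (λ j → b ((σ ^ toℕ j) v))) }

    π-linear : Linear π
    π-linear = record
      { ≋-cong = λ a≋b x → Linear.≋-cong T-linear a≋b (section x)
      ; +-hom  = λ a b x → Linear.+-hom T-linear a b (section x) }

    coord-section : ∀ x → coord (section x) ≡ 0
    coord-section x = coord-σ^ x 0 (s≤s z≤n)

    coord-σ : ∀ v → suc (coord v) < p → coord (σ v) ≡ suc (coord v)
    coord-σ v k+1<p = trans (cong (coord ∘ σ) (sym (σ^coord v))) (coord-σ^ (proj v) (suc (coord v)) k+1<p)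

    σ-wraps : ∀ v → suc (coord v) ≡ p → σ v ≡ section (proj v)
    σ-wraps v k+1≡p = trans (cong σ (sym (σ^coord v)))
                            (trans (cong (λ n → (σ ^ n) (section (proj v))) k+1≡p) (σ^p (section (proj v))))

    coord-σ≈ : ∀ v → + coord (σ v) ≈ + coord v + 1ℤ
    coord-σ≈ v with ℕ.m≤n⇒m<n∨m≡n (coord<p v)
    ... | inj₁ k+1<p = ≡⇒≈ (trans (cong +_ (coord-σ v k+1<p)) (+suc (coord v)))
    ... | inj₂ k+1≡p = begin
      + coord (σ v)          ≡⟨ cong +_ (trans (cong coord (σ-wraps v k+1≡p)) (coord-section (proj v))) ⟩
      0ℤ                     ≈⟨ ≈-sym (*p≈0 1ℤ) ⟩
      1ℤ * + p               ≡⟨ ℤ.*-identityˡ (+ p) ⟩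
      + p                    ≡⟨ cong +_ (sym k+1≡p) ⟩
      + suc (coord v)        ≡⟨ +suc (coord v) ⟩
      + coord v + 1ℤ         ∎
      where open ≈-Reasoning

    -- b v sums c along the orbit of v up to v; where N b wraps around an orbit, π c ≈ 0 enters.
    ker-π⊆im-N : ∀ c → π c ≋ 0ᶜ → Σ (Ch Tot) λ b → c ≋ N b
    ker-π⊆im-N c πc≈0 = b , N-b
      where
      along : Base → ℕ → ℤ
      along x j = c ((σ ^ j) (section x))
      b : Ch Tot
      b v = sumTo (coord v) (along (proj v))
      N-b : ∀ v → c v ≈ N b v
      N-b v with ℕ.m≤n⇒m<n∨m≡n (coord<p v)
      ... | inj₁ k+1<p = ≡⇒≈ (begin
        c v                                    ≡⟨ c-v ⟩
        along x k                              ≡⟨ sym (cancel (sumTo k (along x)) (along x k)) ⟩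
        (sumTo k (along x) + along x k) - b v  ≡⟨ cong (_- b v) (sym (sumTo-snoc k (along x))) ⟩
        sumTo (suc k) (along x) - b v          ≡⟨ cong (_- b v) (sym b-σv) ⟩
        b (σ v) - b v                          ∎)
        where
        open ≡-Reasoning
        x = proj v
        k = coord v
        c-v : c v ≡ along x k
        c-v = cong c (sym (σ^coord v))
        b-σv : b (σ v) ≡ sumTo (suc k) (along x)
        b-σv = cong₂ (λ i y → sumTo i (along y)) (coord-σ v k+1<p) (proj-σ v)
        cancel : ∀ a x → (a + x) - a ≡ x
        cancel = solve-∀
      ... | inj₂ k+1≡p = begin
        c v                                      ≡⟨ cong c (sym (σ^coord v)) ⟩
        along x k                                ≡⟨ sym (cancel (b v) (along x k)) ⟩
        (b v + along x k) - b v                  ≡⟨ cong (_- b v) (sym (sumTo-snoc k (along x))) ⟩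
        sumTo (suc k) (along x) - b v            ≡⟨ cong (λ n → sumTo n (along x) - b v) k+1≡p ⟩
        π c x - b v                              ≈⟨ sub-congʳ (b v) (πc≈0 x) ⟩
        0ℤ - b v                                 ≡⟨ cong (_- b v) (sym b-σv) ⟩
        b (σ v) - b v                            ∎
        where
        open ≈-Reasoning
        x = proj v
        k = coord v
        b-σv : b (σ v) ≡ 0ℤ
        b-σv = cong (λ i → sumTo i (along (proj (σ v)))) (trans (cong coord (σ-wraps v k+1≡p)) (coord-section x))
        cancel : ∀ a x → (a + x) - a ≡ x
        cancel = solve-∀

    σ-invariant : ∀ c → N c ≋ 0ᶜ → ∀ j v → c ((σ ^ j) v) ≈ c v
    σ-invariant c Nc≈0 zero    v = ≈-refl
    σ-invariant c Nc≈0 (suc j) v = ≈-trans step (σ-invariant c Nc≈0 j v)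
      where
      w = (σ ^ j) v
      split : ∀ a b → b ≡ a + (b - a)
      split = solve-∀
      step : c (σ w) ≈ c w
      step = ≈-trans (≡⇒≈ (split (c w) (c (σ w))))
                     (≈-trans (+-congˡ (c w) (Nc≈0 w)) (≡⇒≈ (ℤ.+-identityʳ (c w))))

    ker-N⊆im-T : ∀ c → N c ≋ 0ᶜ → Σ (Ch Tot) λ b → c ≋ T b
    ker-N⊆im-T c Nc≈0 = lift (c ∘ section) , λ v → ≈-sym (begin
      T (lift (c ∘ section)) v                  ≡⟨ T-lift (c ∘ section) v ⟩
      c (section (proj v))                      ≈⟨ ≈-sym (σ-invariant c Nc≈0 (coord v) (section (proj v))) ⟩
      c ((σ ^ coord v) (section (proj v)))      ≡⟨ cong c (σ^coord v) ⟩
      c v                                       ∎)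
      where open ≈-Reasoning

    N^-on-orbit : ∀ k c i v → (N ^ k) c ((σ ^ i) v) ≡ (Δ ^ k) (λ j → c ((σ ^ j) v)) i
    N^-on-orbit zero    c i v = refl
    N^-on-orbit (suc k) c i v = cong₂ _-_ (N^-on-orbit k c (suc i) v) (N^-on-orbit k c i v)

    N^p≋0 : ∀ c → (N ^ p) c ≋ 0ᶜ
    N^p≋0 c v = ≈-trans (≡⇒≈ (N^-on-orbit p c 0 v))
                        (periodic⇒Δ^p≈0 p-prime (λ j → c ((σ ^ j) v)) (cong c (σ^p v)))

  open FreeZpSet

  record Morphism {U D U′ D′ : Set} (S : FreeZpSet U D) (R : FreeZpSet U′ D′) : Set where
    field
      up          : Ch U → Ch U′
      down        : Ch D → Ch D′
      up-linear   : Linear up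
      down-linear : Linear down
      equivariant : ∀ a → up (a ∘ σ S) ≋ up a ∘ σ R
      natural     : ∀ a → π R (up a) ≋ down (π S a)

    open Linear up-linear

    up-N : ∀ a → up (N S a) ≋ N R (up a)
    up-N a v = ≈-trans (-hom (a ∘ σ S) a v) (sub-congʳ (up a v) (equivariant a v))

    up-N^ : ∀ k a → up ((N S ^ k) a) ≋ (N R ^ k) (up a)
    up-N^ zero    a v = ≈-refl
    up-N^ (suc k) a v = ≈-trans (up-N ((N S ^ k) a) v) (Linear.≋-cong (N-linear R) (up-N^ k a) v)

    up-σ^ : ∀ j a → up (a ∘ (σ S ^ j)) ≋ up a ∘ (σ R ^ j)
    up-σ^ zero    a v = ≈-refl
    up-σ^ (suc j) a v = ≈-trans (up-σ^ j (a ∘ σ S) v) (equivariant a ((σ R ^ j) v))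

    up-T : ∀ a → up (T S a) ≋ T R (up a)
    up-T a v = ≈-trans (sumTo-hom p (λ j → a ∘ (σ S ^ j)) v) (sumFin-cong≈ p (λ j → up-σ^ (toℕ j) a v))


module ExactnessLifting (p-1 : ℕ) (p-prime : Prime (suc p-1)) where

  open ZpChains p-1 p-prime

  open FreeZpSet
  open Morphism

  Exact : ∀ {A B C : Set} → (Ch A → Ch B) → (Ch B → Ch C) → Set
  Exact {A} f g = ∀ b → g b ≋ 0ᶜ → Σ (Ch A) λ a → f a ≋ b

  module _ {U D U′ D′ : Set} {S : FreeZpSet U D} {R : FreeZpSet U′ D′} (f : Morphism S R) where

    π-correction≋0 : ∀ c a → down f a ≋ π R c → π R (c -ᶜ up f (lift S a)) ≋ 0ᶜ
    π-correction≋0 c a fa≋πc x = begin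
      π R (c -ᶜ up f b) x               ≈⟨ Linear.-hom (π-linear R) c (up f b) x ⟩
      π R c x - π R (up f b) x          ≈⟨ sub-congˡ (π R c x) (natural f b x) ⟩
      π R c x - down f (π S b) x        ≈⟨ sub-congˡ (π R c x) (Linear.≋-cong (down-linear f) (λ y → ≡⇒≈ (π-lift S a y)) x) ⟩
      π R c x - down f a x              ≈⟨ sub-congˡ (π R c x) (fa≋πc x) ⟩
      π R c x - π R c x                 ≡⟨ ℤ.+-inverseʳ (π R c x) ⟩
      0ℤ                                ∎
      where
      open ≈-Reasoning
      b = lift S a

    im-down⇒im-up+im-N : ∀ c a → down f a ≋ π R c → Σ (Ch U) λ b → Σ (Ch U′) λ y → c ≋ up f b +ᶜ N R y
    im-down⇒im-up+im-N c a fa≋πc = b , proj₁ rest∈im-N , λ v →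
      ≈-trans (≡⇒≈ (split (up f b v) (c v))) (+-congˡ (up f b v) (proj₂ rest∈im-N v))
      where
      b = lift S a
      rest∈im-N = ker-π⊆im-N R (c -ᶜ up f b) (π-correction≋0 c a fa≋πc)
      split : ∀ a c → c ≡ a + (c - a)
      split = solve-∀

  module _ {U₃ D₃ U₂ D₂ U₁ D₁ U₀ D₀ : Set}
           {S₃ : FreeZpSet U₃ D₃} {S₂ : FreeZpSet U₂ D₂} {S₁ : FreeZpSet U₁ D₁} {S₀ : FreeZpSet U₀ D₀}
           (g : Morphism S₃ S₂) (h : Morphism S₂ S₁) (k : Morphism S₁ S₀)
           (hg≋0 : ∀ a → up h (up g a) ≋ 0ᶜ) (kh≋0 : ∀ a → up k (up h a) ≋ 0ᶜ)
           (exact↓₂ : Exact (down g) (down h)) (exact↓₁ : Exact (down h) (down k)) where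

    private
      module h↑ = Linear (up-linear h)
      module g↑ = Linear (up-linear g)
      module N₂ = Linear (N-linear S₂)

    Cycle : Ch U₂ → Set
    Cycle e = up h e ≋ 0ᶜ

    -- Since Nᵖ ≈ 0, a decomposition with n = p exhibits e as a boundary.
    Decomposes : ℕ → Ch U₂ → Set
    Decomposes n e = Σ (Ch U₃) λ b → Σ (Ch U₂) λ y → Cycle y × e ≋ up g b +ᶜ (N S₂ ^ n) y

    cycle≋im-g+im-N : ∀ e → Cycle e → Σ (Ch U₃) λ b → Σ (Ch U₂) λ y → e ≋ up g b +ᶜ N S₂ y
    cycle≋im-g+im-N e e-cycle = im-down⇒im-up+im-N g e (proj₁ πe∈im-g) (proj₂ πe∈im-g)
      where
      πe-cycle : down h (π S₂ e) ≋ 0ᶜ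
      πe-cycle x = ≈-trans (≈-sym (natural h e x))
                           (≈-trans (Linear.≋-cong (π-linear S₁) e-cycle x) (Linear.0-hom (π-linear S₁) x))
      πe∈im-g = exact↓₂ (π S₂ e) πe-cycle

    -- If N (h y) ≈ 0 then h y ≈ T w; the image of w downstairs is a cycle, and correcting w
    -- as above shows T w ≈ h (T t), so y - T t is a cycle with the same N-image as y.
    N-cycle⇒cycle : ∀ y → N S₁ (up h y) ≋ 0ᶜ → Σ (Ch U₂) λ t → Cycle (y -ᶜ T S₂ t)
    N-cycle⇒cycle y Nhy≋0 = t , λ v → begin
      up h (y -ᶜ T S₂ t) v                  ≈⟨ h↑.-hom y (T S₂ t) v ⟩
      up h y v - up h (T S₂ t) v            ≈⟨ sub-cong (hy≋Tw v) (up-T h t v) ⟩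
      T S₁ w v - T S₁ (up h t) v            ≈⟨ sub-congʳ (T S₁ (up h t) v) (Tw≋Tht v) ⟩
      T S₁ (up h t) v - T S₁ (up h t) v     ≡⟨ ℤ.+-inverseʳ (T S₁ (up h t) v) ⟩
      0ℤ                                    ∎
      where
      open ≈-Reasoning
      hy∈im-T = ker-N⊆im-T S₁ (up h y) Nhy≋0
      w = proj₁ hy∈im-T
      hy≋Tw = proj₂ hy∈im-T
      πw-cycle : down k (π S₁ w) ≋ 0ᶜ
      πw-cycle x = begin
        down k (π S₁ w) x                    ≈⟨ ≈-sym (natural k w x) ⟩
        T S₀ (up k w) (section S₀ x)         ≈⟨ ≈-sym (up-T k w (section S₀ x)) ⟩
        up k (T S₁ w) (section S₀ x)         ≈⟨ Linear.≋-cong (up-linear k) (λ v → ≈-sym (hy≋Tw v)) (section S₀ x) ⟩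
        up k (up h y) (section S₀ x)         ≈⟨ kh≋0 y (section S₀ x) ⟩
        0ℤ                                   ∎
      πw∈im-h = exact↓₁ (π S₁ w) πw-cycle
      w-decomposed = im-down⇒im-up+im-N h w (proj₁ πw∈im-h) (proj₂ πw∈im-h)
      t = proj₁ w-decomposed
      u = proj₁ (proj₂ w-decomposed)
      w≋ht+Nu = proj₂ (proj₂ w-decomposed)
      module T₁ = Linear (T-linear S₁)
      Tw≋Tht : T S₁ w ≋ T S₁ (up h t)
      Tw≋Tht v = begin
        T S₁ w v                                ≈⟨ T₁.≋-cong w≋ht+Nu v ⟩
        T S₁ (up h t +ᶜ N S₁ u) v               ≈⟨ T₁.+-hom (up h t) (N S₁ u) v ⟩
        T S₁ (up h t) v + T S₁ (N S₁ u) v       ≈⟨ +-congˡ (T S₁ (up h t) v) (T∘N≋0 S₁ u v) ⟩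
        T S₁ (up h t) v + 0ℤ                    ≡⟨ ℤ.+-identityʳ (T S₁ (up h t) v) ⟩
        T S₁ (up h t) v                         ∎

    cycle-decomposes : ∀ e → Cycle e → Decomposes 1 e
    cycle-decomposes e e-cycle = b , y -ᶜ T S₂ t , proj₂ adjusted , λ v → begin
      e v                                        ≈⟨ e≋gb+Ny v ⟩
      up g b v + N S₂ y v                        ≈⟨ +-congˡ (up g b v) (≈-sym (N-unchanged v)) ⟩
      up g b v + N S₂ (y -ᶜ T S₂ t) v            ∎
      where
      open ≈-Reasoning
      decomposed = cycle≋im-g+im-N e e-cycle
      b = proj₁ decomposed
      y = proj₁ (proj₂ decomposed)
      e≋gb+Ny = proj₂ (proj₂ decomposed)
      cancel : ∀ a x → (a + x) - a ≡ x
      cancel = solve-∀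
      Ny≋e-gb : N S₂ y ≋ e -ᶜ up g b
      Ny≋e-gb v = ≈-trans (≡⇒≈ (sym (cancel (up g b v) (N S₂ y v)))) (sub-congʳ (up g b v) (≈-sym (e≋gb+Ny v)))
      Nhy≋0 : N S₁ (up h y) ≋ 0ᶜ
      Nhy≋0 v = begin
        N S₁ (up h y) v                        ≈⟨ ≈-sym (up-N h y v) ⟩
        up h (N S₂ y) v                        ≈⟨ h↑.≋-cong Ny≋e-gb v ⟩
        up h (e -ᶜ up g b) v                   ≈⟨ h↑.-hom e (up g b) v ⟩
        up h e v - up h (up g b) v             ≈⟨ sub-cong (e-cycle v) (hg≋0 b v) ⟩
        0ℤ - 0ℤ                                ≡⟨⟩
        0ℤ                                     ∎
      adjusted = N-cycle⇒cycle y Nhy≋0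
      t = proj₁ adjusted
      N-unchanged : N S₂ (y -ᶜ T S₂ t) ≋ N S₂ y
      N-unchanged v = begin
        N S₂ (y -ᶜ T S₂ t) v                     ≈⟨ N₂.-hom y (T S₂ t) v ⟩
        N S₂ y v - N S₂ (T S₂ t) v               ≈⟨ sub-congˡ (N S₂ y v) (N∘T≋0 S₂ t v) ⟩
        N S₂ y v - 0ℤ                            ≡⟨ ℤ.+-identityʳ (N S₂ y v) ⟩
        N S₂ y v                                 ∎

    decomposes-suc : ∀ n e → Decomposes n e → Decomposes (suc n) e
    decomposes-suc n e (b , y , y-cycle , e≋) = b +ᶜ (N S₃ ^ n) b′ , y′ , y′-cycle , λ v → begin
      e v
        ≈⟨ e≋ v ⟩
      up g b v + (N S₂ ^ n) y v
        ≈⟨ +-congˡ (up g b v) (Nⁿ.≋-cong y≋ v) ⟩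
      up g b v + (N S₂ ^ n) (up g b′ +ᶜ N S₂ y′) v
        ≈⟨ +-congˡ (up g b v) (Nⁿ.+-hom (up g b′) (N S₂ y′) v) ⟩
      up g b v + ((N S₂ ^ n) (up g b′) v + (N S₂ ^ n) (N S₂ y′) v)
        ≈⟨ +-congˡ (up g b v) (+-cong (≈-sym (up-N^ g n b′ v)) (≡⇒≈ (cong (λ F → F v) (sym (^-suc (N S₂) n y′))))) ⟩
      up g b v + (up g ((N S₃ ^ n) b′) v + (N S₂ ^ suc n) y′ v)
        ≈⟨ ≡⇒≈ (sym (ℤ.+-assoc (up g b v) _ _)) ⟩
      up g b v + up g ((N S₃ ^ n) b′) v + (N S₂ ^ suc n) y′ v
        ≈⟨ +-congʳ ((N S₂ ^ suc n) y′ v) (≈-sym (g↑.+-hom b ((N S₃ ^ n) b′) v)) ⟩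
      up g (b +ᶜ (N S₃ ^ n) b′) v + (N S₂ ^ suc n) y′ v          ∎
      where
      open ≈-Reasoning
      decomposed = cycle-decomposes y y-cycle
      b′ = proj₁ decomposed
      y′ = proj₁ (proj₂ decomposed)
      y′-cycle = proj₁ (proj₂ (proj₂ decomposed))
      y≋ = proj₂ (proj₂ (proj₂ decomposed))
      module Nⁿ = Linear (^-linear (N-linear S₂) n)

    decomposes : ∀ n e → Cycle e → Decomposes n e
    decomposes zero    e e-cycle = 0ᶜ , e , e-cycle , λ v → ≈-trans (≡⇒≈ (sym (ℤ.+-identityˡ (e v))))
                                                                     (+-congʳ (e v) (≈-sym (g↑.0-hom v)))
    decomposes (suc n) e e-cycle = decomposes-suc n e (decomposes n e e-cycle)

    exact↑ : Exact (up g) (up h)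
    exact↑ e e-cycle = b , λ v → ≈-sym (≈-trans (e≋ v) (≈-trans (+-congˡ (up g b v) (N^p≋0 S₂ y v))
                                                                  (≡⇒≈ (ℤ.+-identityʳ (up g b v)))))
      where
      decomposed = decomposes p e e-cycle
      b = proj₁ decomposed
      y = proj₁ (proj₂ decomposed)
      e≋ = proj₂ (proj₂ (proj₂ decomposed))


module RegularCovers (p-1 : ℕ) (p-prime : Prime (suc p-1)) where

  open ZpChains p-1 p-prime using (p; FreeZpSet)

  1<p : 1 ℕ.< p
  1<p = ℕ.nonTrivial⇒n>1 p {{prime⇒nonTrivial p-prime}}

  module RegularCoverStructure {Y X : Graph} (c : Hom Y X) (cover : RegularCover p c) (x₀ : V X) where

    open RegularCover cover

    point : ∀ x → Fin p → V Y
    point x i = proj₁ (Inverse.to (degree x) i)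

    point-over : ∀ x i → vmap c (point x i) ≡ x
    point-over x i = proj₂ (Inverse.to (degree x) i)

    index : ∀ x v → vmap c v ≡ x → Fin p
    index x v v↦x = Inverse.from (degree x) (v , v↦x)

    point-index : ∀ x v v↦x → point x (index x v v↦x) ≡ v
    point-index x v v↦x = cong proj₁ (Inverse.strictlyInverseˡ (degree x) (v , v↦x))

    index-injective : ∀ x {v w} v↦x w↦x → index x v v↦x ≡ index x w w↦x → v ≡ w
    index-injective x v↦x w↦x same = trans (sym (point-index x _ v↦x)) (trans (cong (point x) same) (point-index x _ w↦x))

    point-injective : ∀ x {i j} → point x i ≡ point x j → i ≡ j
    point-injective x {i} {j} same = begin
      i                  ≡⟨ sym (Inverse.strictlyInverseʳ (degree x) i) ⟩
      from (to i)        ≡⟨ cong from (Σ-≡,≡→≡ (same , Decidable⇒UIP.≡-irrelevant _≟_ _ _)) ⟩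
      from (to j)        ≡⟨ Inverse.strictlyInverseʳ (degree x) j ⟩
      j                  ∎
      where
      open ≡-Reasoning
      open Inverse (degree x) using (to; from)

    immersion : Immersion c
    immersion = proj₁ covering

    v₀ v₁ : V Y
    v₀ = point x₀ zero
    v₁ = point x₀ (fromℕ< 1<p)

    v₀≢v₁ : v₀ ≢ v₁
    v₀≢v₁ v₀≡v₁ = contradiction (trans (cong toℕ (point-injective x₀ v₀≡v₁)) (Fin.toℕ-fromℕ< 1<p)) λ ()

    private
      v₀↦v₁ = regular v₀ v₁ (trans (point-over x₀ zero) (sym (point-over x₀ _)))

    deck : Hom Y Y
    deck = proj₁ v₀↦v₁

    deck-over-v : ∀ v → vmap c (vmap deck v) ≡ vmap c v
    deck-over-v = proj₁ (proj₂ (proj₁ (proj₂ v₀↦v₁)))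

    deck-over-e : ∀ e → emap c (emap deck e) ≡ emap c e
    deck-over-e = proj₂ (proj₂ (proj₁ (proj₂ v₀↦v₁)))

    deck-v₀≡v₁ : vmap deck v₀ ≡ v₁
    deck-v₀≡v₁ = proj₂ (proj₂ v₀↦v₁)

    deck^-over-v : ∀ k v → vmap c ((vmap deck ^ k) v) ≡ vmap c v
    deck^-over-v zero    v = refl
    deck^-over-v (suc k) v = trans (deck-over-v _) (deck^-over-v k v)

    deck^-over-e : ∀ k e → emap c ((emap deck ^ k) e) ≡ emap c e
    deck^-over-e zero    e = refl
    deck^-over-e (suc k) e = trans (deck-over-e _) (deck^-over-e k e)

    module _ (k : ℕ) (w : V Y) (fixed : (vmap deck ^ k) w ≡ w) where
      open UniqueLifting c immersion (deck ^ʰ k) idʰ (deck^-over-e k) 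

      fixed-vertex⇒id : ∀ v → (vmap deck ^ k) v ≡ v
      fixed-vertex⇒id = vertices-agree connected w fixed

      fixed-vertex⇒idᵉ : ∀ e → (emap deck ^ k) e ≡ e
      fixed-vertex⇒idᵉ = edges-agree connected w fixed

    -- The p + 1 points σ^k v₀, k ≤ p, lie in a fibre of size p.
    v₀-returns : Σ ℕ λ d → (vmap deck ^ suc d) v₀ ≡ v₀
    v₀-returns = d , fixed-vertex⇒id (suc d) ((vmap deck ^ toℕ i) v₀) fixes-σⁱv₀ v₀
      where
      collision = Fin.pigeonhole (ℕ.n<1+n p) (λ k → index x₀ ((vmap deck ^ toℕ k) v₀) (trans (deck^-over-v (toℕ k) v₀) (point-over x₀ zero)))
      i = proj₁ collision
      j = proj₁ (proj₂ collision)
      i<j = proj₁ (proj₂ (proj₂ collision))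
      σⁱv₀≡σʲv₀ = index-injective x₀ _ _ (proj₂ (proj₂ (proj₂ collision)))
      d = ℕ.pred (toℕ j ℕ.∸ toℕ i)
      fixes-σⁱv₀ : (vmap deck ^ suc d) ((vmap deck ^ toℕ i) v₀) ≡ (vmap deck ^ toℕ i) v₀
      fixes-σⁱv₀ = trans (cong (λ n → (vmap deck ^ n) ((vmap deck ^ toℕ i) v₀)) (ℕ.suc-pred (toℕ j ℕ.∸ toℕ i) {{ℕ.>-nonZero (ℕ.m<n⇒0<n∸m i<j)}}))
                         (trans (^-∸ (vmap deck) v₀ (ℕ.<⇒≤ i<j)) (sym σⁱv₀≡σʲv₀))

    private
      order = minimal (λ d → (vmap deck ^ suc d) v₀ Fin.≟ v₀) {proj₁ v₀-returns} (proj₂ v₀-returns)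

    m : ℕ
    m = suc (proj₁ order)

    deck^m≡id : ∀ v → (vmap deck ^ m) v ≡ v
    deck^m≡id = fixed-vertex⇒id m v₀ (proj₁ (proj₂ order))

    deck-free : ∀ w j → 0 ℕ.< j → j ℕ.< m → (vmap deck ^ j) w ≢ w
    deck-free w (suc j) _ (ℕ.s≤s j<m-1) fixed = proj₂ (proj₂ order) j<m-1 (fixed-vertex⇒id (suc j) w fixed v₀)

    τ : Fin p → Fin p
    τ i = index x₀ (vmap deck (point x₀ i)) (trans (deck-over-v _) (point-over x₀ i))

    point-τ^ : ∀ j i → point x₀ ((τ ^ j) i) ≡ (vmap deck ^ j) (point x₀ i)
    point-τ^ zero    i = refl
    point-τ^ (suc j) i = trans (point-index x₀ _ _) (cong (vmap deck) (point-τ^ j i))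

    τ^m≡id : ∀ i → (τ ^ m) i ≡ i
    τ^m≡id i = point-injective x₀ (trans (point-τ^ m i) (deck^m≡id _))

    τ-free : Periodic.Free τ m τ^m≡id
    τ-free i j 0<j j<m fixed = deck-free (point x₀ i) j 0<j j<m (trans (sym (point-τ^ j i)) (cong (point x₀) fixed))

    m≢1 : m ≢ 1
    m≢1 m≡1 = v₀≢v₁ (sym (trans (sym deck-v₀≡v₁) (trans (cong (λ n → (vmap deck ^ n) v₀) (sym m≡1)) (deck^m≡id v₀))))

    -- The orbits of the deck transformation on the fibre over x₀ (of size p) all have size m.
    m≡p : m ≡ p
    m≡p = m≢1⇒m≡p (prime⇒irreducible p-prime (OrbitCounting.orbits-divide τ m τ^m≡id τ-free))
      where
      m≢1⇒m≡p : m ≡ 1 ⊎ m ≡ p → m ≡ p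
      m≢1⇒m≡p (inj₁ m≡1) = contradiction m≡1 m≢1
      m≢1⇒m≡p (inj₂ m≡p) = m≡p

    deck^p≡id : ∀ v → (vmap deck ^ p) v ≡ v
    deck^p≡id v = subst (λ n → (vmap deck ^ n) v ≡ v) m≡p (deck^m≡id v)

    deck^p≡idᵉ : ∀ e → (emap deck ^ p) e ≡ e
    deck^p≡idᵉ = fixed-vertex⇒idᵉ p v₀ (deck^p≡id v₀)

    open Periodic (vmap deck) p deck^p≡id using (Free; exponent-unique)

    deck-free-p : Free
    deck-free-p w j 0<j j<p = deck-free w j 0<j (subst (j ℕ.<_) (sym m≡p) j<p)

    section : V X → V Y
    section x = point x zero

    deck^-section-over : ∀ j x → vmap c ((vmap deck ^ j) (section x)) ≡ x
    deck^-section-over j x = trans (deck^-over-v j (section x)) (point-over x zero)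

    candidate : V Y → Fin (suc p) → Fin p
    candidate v zero    = index (vmap c v) v refl
    candidate v (suc j) = index (vmap c v) ((vmap deck ^ toℕ j) (section (vmap c v))) (deck^-section-over (toℕ j) (vmap c v))

    -- v and the p distinct points σʲ (section x), j < p, all lie in a fibre of size p.
    in-orbit : ∀ v → Σ (Fin p) λ j → (vmap deck ^ toℕ j) (section (vmap c v)) ≡ v
    in-orbit v = from-collision (Fin.pigeonhole (ℕ.n<1+n p) (candidate v))
      where
      from-collision : (∃₂ λ i j → toℕ i ℕ.< toℕ j × candidate v i ≡ candidate v j) →
                       Σ (Fin p) λ j → (vmap deck ^ toℕ j) (section (vmap c v)) ≡ v
      from-collision (zero  , zero  , ()  , _)
      from-collision (suc _ , zero  , ()  , _)
      from-collision (zero  , suc j , _   , same) = j , sym (index-injective _ _ _ same)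
      from-collision (suc i , suc j , i<j , same) =
        contradiction (exponent-unique deck-free-p _ (Fin.toℕ<n i) (Fin.toℕ<n j) (index-injective _ _ _ same)) (ℕ.<⇒≢ (ℕ.≤-pred i<j))

    coord : V Y → ℕ
    coord v = toℕ (proj₁ (in-orbit v))

    coord-σ^ : ∀ x j → j ℕ.< p → coord ((vmap deck ^ j) (section x)) ≡ j
    coord-σ^ x j j<p = exponent-unique deck-free-p (section x) (Fin.toℕ<n _) j<p
      (trans (cong (λ y → (vmap deck ^ coord w) (section y)) (sym (deck^-section-over j x))) (proj₂ (in-orbit w)))
      where w = (vmap deck ^ j) (section x)

    vertices : FreeZpSet (V Y) (V X)
    vertices = record
      { proj = vmap c ; σ = vmap deck ; section = section ; coord = coord ; coord<p = λ v → Fin.toℕ<n _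
      ; proj-σ = deck-over-v ; proj-section = λ x → point-over x zero ; σ^coord = λ v → proj₂ (in-orbit v)
      ; coord-σ^ = coord-σ^ ; σ^p = deck^p≡id }

    private
      lift-at-section : ∀ x → ∃ λ e → src Y e ≡ section (src X x) × emap c e ≡ x
      lift-at-section x = proj₁ (proj₂ covering) (section (src X x)) x (sym (point-over (src X x) zero))

    sectionᵉ : E X → E Y
    sectionᵉ x = proj₁ (lift-at-section x)

    deck^coordᵉ : ∀ e → (emap deck ^ coord (src Y e)) (sectionᵉ (emap c e)) ≡ e
    deck^coordᵉ e = proj₁ immersion _ e (trans (deck^-over-e k _) (proj₂ (proj₂ (lift-at-section (emap c e)))))
      (begin
        src Y ((emap deck ^ k) (sectionᵉ (emap c e)))         ≡⟨ src-hom (deck ^ʰ k) _ ⟩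
        (vmap deck ^ k) (src Y (sectionᵉ (emap c e)))         ≡⟨ cong (vmap deck ^ k) (proj₁ (proj₂ (lift-at-section (emap c e)))) ⟩
        (vmap deck ^ k) (section (src X (emap c e)))          ≡⟨ cong (λ x → (vmap deck ^ k) (section x)) (src-hom c e) ⟩
        (vmap deck ^ k) (section (vmap c (src Y e)))          ≡⟨ proj₂ (in-orbit (src Y e)) ⟩
        src Y e                                               ∎)
      where
      open ≡-Reasoning
      k = coord (src Y e)

    edges : FreeZpSet (E Y) (E X)
    edges = record
      { proj = emap c ; σ = emap deck ; section = sectionᵉ ; coord = coord ∘ src Y ; coord<p = λ e → Fin.toℕ<n _
      ; proj-σ = deck-over-e ; proj-section = λ x → proj₂ (proj₂ (lift-at-section x)) ; σ^coord = deck^coordᵉ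
      ; coord-σ^ = λ x j j<p → trans (cong coord (trans (src-hom (deck ^ʰ j) (sectionᵉ x)) (cong (vmap deck ^ j) (proj₁ (proj₂ (lift-at-section x))))))
                                     (coord-σ^ (src X x) j j<p)
      ; σ^p = deck^p≡idᵉ }


module ZpSetConstructions (p-1 : ℕ) (p-prime : Prime (suc p-1)) where

  open ZpChains p-1 p-prime

  open FreeZpSet

  module Pullback {U D D′ P : Set} (S : FreeZpSet U D) (g : D′ → D) (g′ : P → D′) (ĝ : P → U)
                  (commutes : ∀ v → g (g′ v) ≡ proj S (ĝ v))
                  (jointly-injective : ∀ v w → g′ v ≡ g′ w → ĝ v ≡ ĝ w → v ≡ w)
                  (jointly-surjective : ∀ x y → g x ≡ proj S y → ∃ λ v → g′ v ≡ x × ĝ v ≡ y) where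

    private
      shifted : ∀ v → ∃ λ w → g′ w ≡ g′ v × ĝ w ≡ σ S (ĝ v)
      shifted v = jointly-surjective (g′ v) (σ S (ĝ v)) (trans (commutes v) (sym (proj-σ S (ĝ v))))

      over-section : ∀ x → ∃ λ w → g′ w ≡ x × ĝ w ≡ section S (g x)
      over-section x = jointly-surjective x (section S (g x)) (sym (proj-section S (g x)))

    σ′ : P → P
    σ′ v = proj₁ (shifted v)

    g′-σ′ : ∀ v → g′ (σ′ v) ≡ g′ v
    g′-σ′ v = proj₁ (proj₂ (shifted v))

    ĝ-σ′ : ∀ v → ĝ (σ′ v) ≡ σ S (ĝ v)
    ĝ-σ′ v = proj₂ (proj₂ (shifted v))

    g′-σ′^ : ∀ j v → g′ ((σ′ ^ j) v) ≡ g′ v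
    g′-σ′^ zero    v = refl
    g′-σ′^ (suc j) v = trans (g′-σ′ _) (g′-σ′^ j v)

    ĝ-σ′^ : ∀ j v → ĝ ((σ′ ^ j) v) ≡ (σ S ^ j) (ĝ v)
    ĝ-σ′^ zero    v = refl
    ĝ-σ′^ (suc j) v = trans (ĝ-σ′ _) (cong (σ S) (ĝ-σ′^ j v))

    section′ : D′ → P
    section′ x = proj₁ (over-section x)

    structure : FreeZpSet P D′
    structure = record
      { proj = g′ ; σ = σ′ ; section = section′ ; coord = coord S ∘ ĝ ; coord<p = coord<p S ∘ ĝ
      ; proj-σ = g′-σ′ ; proj-section = proj₁ ∘ proj₂ ∘ over-section
      ; σ^coord = λ v → jointly-injective _ v
          (trans (g′-σ′^ (coord S (ĝ v)) (section′ (g′ v))) (proj₁ (proj₂ (over-section (g′ v)))))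
          (trans (ĝ-σ′^ (coord S (ĝ v)) (section′ (g′ v)))
                 (trans (cong (σ S ^ coord S (ĝ v)) (trans (proj₂ (proj₂ (over-section (g′ v)))) (cong (section S) (commutes v))))
                        (σ^coord S (ĝ v))))
      ; coord-σ^ = λ x j j<p → trans (cong (coord S) (trans (ĝ-σ′^ j (section′ x)) (cong (σ S ^ j) (proj₂ (proj₂ (over-section x))))))
                                     (coord-σ^ S (g x) j j<p)
      ; σ^p = λ v → jointly-injective _ v (g′-σ′^ p v) (trans (ĝ-σ′^ p v) (σ^p S (ĝ v)))
      }

  module _ {U D U′ D′ : Set} (S : FreeZpSet U D) (R : FreeZpSet U′ D′) where

    private
      σ⊎ : U ⊎ U′ → U ⊎ U′
      σ⊎ = Sum.map (σ S) (σ R)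

      σ⊎^-inj₁ : ∀ k v → (σ⊎ ^ k) (inj₁ v) ≡ inj₁ ((σ S ^ k) v)
      σ⊎^-inj₁ zero    v = refl
      σ⊎^-inj₁ (suc k) v = cong σ⊎ (σ⊎^-inj₁ k v)

      σ⊎^-inj₂ : ∀ k v → (σ⊎ ^ k) (inj₂ v) ≡ inj₂ ((σ R ^ k) v)
      σ⊎^-inj₂ zero    v = refl
      σ⊎^-inj₂ (suc k) v = cong σ⊎ (σ⊎^-inj₂ k v)

    infixr 1 _⊎ᶠ_
    _⊎ᶠ_ : FreeZpSet (U ⊎ U′) (D ⊎ D′)
    _⊎ᶠ_ = record
      { proj = Sum.map (proj S) (proj R) ; σ = σ⊎ ; section = Sum.map (section S) (section R)
      ; coord = Sum.[ coord S , coord R ] ; coord<p = Sum.[ coord<p S , coord<p R ]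
      ; proj-σ = Sum.[ cong inj₁ ∘ proj-σ S , cong inj₂ ∘ proj-σ R ]
      ; proj-section = Sum.[ cong inj₁ ∘ proj-section S , cong inj₂ ∘ proj-section R ]
      ; σ^coord = Sum.[ (λ v → trans (σ⊎^-inj₁ (coord S v) (section S (proj S v))) (cong inj₁ (σ^coord S v)))
                      , (λ v → trans (σ⊎^-inj₂ (coord R v) (section R (proj R v))) (cong inj₂ (σ^coord R v))) ]
      ; coord-σ^ = Sum.[ (λ x j j<p → trans (cong Sum.[ coord S , coord R ] (σ⊎^-inj₁ j (section S x))) (coord-σ^ S x j j<p))
                       , (λ x j j<p → trans (cong Sum.[ coord S , coord R ] (σ⊎^-inj₂ j (section R x))) (coord-σ^ R x j j<p)) ]
      ; σ^p = Sum.[ (λ v → trans (σ⊎^-inj₁ p v) (cong inj₁ (σ^p S v))) , (λ v → trans (σ⊎^-inj₂ p v) (cong inj₂ (σ^p R v))) ]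
      }

    π-inj₁ : ∀ (z : Ch (U ⊎ U′)) x → π _⊎ᶠ_ z (inj₁ x) ≡ π S (z ∘ inj₁) x
    π-inj₁ z x = sumFin-cong p (λ j → cong z (σ⊎^-inj₁ (toℕ j) (section S x)))

    π-inj₂ : ∀ (z : Ch (U ⊎ U′)) x → π _⊎ᶠ_ z (inj₂ x) ≡ π R (z ∘ inj₂) x
    π-inj₂ z x = sumFin-cong p (λ j → cong z (σ⊎^-inj₂ (toℕ j) (section R x)))

  ∅ᶠ : FreeZpSet ⊥ ⊥
  ∅ᶠ = record
    { proj = λ () ; σ = λ () ; section = λ () ; coord = λ () ; coord<p = λ () ; proj-σ = λ () ; proj-section = λ ()
    ; σ^coord = λ () ; coord-σ^ = λ () ; σ^p = λ () }

  -- Over x, the fibre is enumerated without repetition by σʲ (section x), j < p.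
  pushforward-proj : ∀ {a b} (S : FreeZpSet (Fin a) (Fin b)) c x → pushforward (proj S) c x ≡ π S c x
  pushforward-proj {a} S c x = begin
    sumFin a (λ i → c i * ind (proj S i) x)
      ≡⟨ sumFin-cong a (λ i → cong (c i *_) (fibre-indicator i)) ⟩
    sumFin a (λ i → c i * sumTo p (λ j → ind i (orbit j)))
      ≡⟨ sumFin-cong a (λ i → *-distribˡ-sumFin p (c i) (λ j → ind i (orbit (toℕ j)))) ⟩
    sumFin a (λ i → sumTo p (λ j → c i * ind i (orbit j)))
      ≡⟨ sumFin-comm a p (λ i j → c i * ind i (orbit (toℕ j))) ⟩
    sumTo p (λ j → sumFin a (λ i → c i * ind i (orbit j)))
      ≡⟨ sumFin-cong p (λ j → sumFin-ind′ a (orbit (toℕ j)) c) ⟩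
    π S c x ∎
    where
    open ≡-Reasoning
    orbit : ℕ → Fin a
    orbit j = (σ S ^ j) (section S x)
    fibre-indicator : ∀ i → ind (proj S i) x ≡ sumTo p (λ j → ind i ((σ S ^ j) (section S x)))
    fibre-indicator i with proj S i ≟ x
    ... | yes refl = sym (trans (sumFin-cong p (λ j → trans (ind-⇔ (at-coord j) (from-coord j)) (sym (ℤ.*-identityʳ _))))
                                (sumFin-ind p k (λ _ → 1ℤ)))
      where
      k = fromℕ< (coord<p S i)
      at-coord : ∀ j → i ≡ (σ S ^ toℕ j) (section S (proj S i)) → k ≡ j
      at-coord j i≡ = Fin.toℕ-injective (trans (Fin.toℕ-fromℕ< (coord<p S i))
                                               (trans (cong (coord S) i≡) (coord-σ^ S (proj S i) (toℕ j) (Fin.toℕ<n j))))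
      from-coord : ∀ j → k ≡ j → i ≡ (σ S ^ toℕ j) (section S (proj S i))
      from-coord j k≡j = trans (sym (σ^coord S i))
                               (cong (λ n → (σ S ^ n) (section S (proj S i))) (trans (sym (Fin.toℕ-fromℕ< (coord<p S i))) (cong toℕ k≡j)))
    ... | no  i∉x  = sym (trans (sumFin-cong p (λ j → ind-≢ λ i≡ → i∉x (trans (cong (proj S) i≡)
                                                                          (trans (proj-σ^ S (toℕ j) _) (proj-section S x)))))
                                (sumFin-zero p))


module MappingCone (p-1 : ℕ) (p-prime : Prime (suc p-1)) where

  open ZpChains p-1 p-prime
  open ExactnessLifting p-1 p-prime using (Exact)
  open Connectivity p using (zero-sum⇒boundary; boundary⇒path)
  open RegularCovers p-1 p-prime using (1<p)

  pushforward-cong≈ : ∀ {m n} (φ : Fin m → Fin n) {c d} → c ≋ d → pushforward φ c ≋ pushforward φ d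
  pushforward-cong≈ {m} φ c≋d y = sumFin-cong≈ m (λ i → *-congʳ (ind (φ i) y) (c≋d i))

  boundary-cong≈ : ∀ G {c d : Chain G} → c ≋ d → boundary G c ≋ boundary G d
  boundary-cong≈ G c≋d v = sumFin-cong≈ (nE G) (λ e → *-congʳ (ind (tgt G e) v - ind (src G e) v) (c≋d e))

  0ᴹ : ∀ {A B : Set} → Ch A → Ch B
  0ᴹ _ _ = 0ℤ

  0ᴹ-linear : ∀ {A B : Set} → Linear (0ᴹ {A} {B})
  0ᴹ-linear = record { ≋-cong = λ _ _ → ≈-refl ; +-hom = λ _ _ _ → ≈-refl }

  ∂cone₂ : ∀ {G H} → Hom G H → Ch (E G) → Ch (E H ⊎ V G)
  ∂cone₂     g a (inj₁ e) = push g a e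
  ∂cone₂ {G} g a (inj₂ v) = - boundary G a v

  ∂cone₁ : ∀ {G H} → Hom G H → Ch (E H ⊎ V G) → Ch (V H)
  ∂cone₁ {G} {H} g z w = boundary H (z ∘ inj₁) w + pushforward (vmap g) (z ∘ inj₂) w

  ∂cone₁∘∂cone₂≡0 : ∀ {G H} (g : Hom G H) a w → ∂cone₁ g (∂cone₂ g a) w ≡ 0ℤ
  ∂cone₁∘∂cone₂≡0 {G} g a w =
    trans (cong₂ _+_ (boundary-push g a w) (pushforward-neg (vmap g) (boundary G a) w))
          (ℤ.+-inverseʳ (pushforward (vmap g) (boundary G a) w))

  ∂cone₂-linear : ∀ {G H} (g : Hom G H) → Linear (∂cone₂ g)
  ∂cone₂-linear {G} g = record { ≋-cong = ≋-cong ; +-hom = +-hom }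
    where
    ≋-cong : ∀ {a b} → a ≋ b → ∂cone₂ g a ≋ ∂cone₂ g b
    ≋-cong a≋b (inj₁ e) = pushforward-cong≈ (emap g) a≋b e
    ≋-cong a≋b (inj₂ v) = -‿cong (boundary-cong≈ G a≋b v)
    +-hom : ∀ a b → ∂cone₂ g (a +ᶜ b) ≋ ∂cone₂ g a +ᶜ ∂cone₂ g b
    +-hom a b (inj₁ e) = ≡⇒≈ (pushforward-+ (emap g) a b e)
    +-hom a b (inj₂ v) = ≡⇒≈ (trans (cong -_ (boundary-+ G a b v)) (ℤ.neg-distrib-+ (boundary G a v) (boundary G b v)))

  ∂cone₁-linear : ∀ {G H} (g : Hom G H) → Linear (∂cone₁ g)
  ∂cone₁-linear {G} {H} g = record
    { ≋-cong = λ z≋z′ w → +-cong (boundary-cong≈ H (z≋z′ ∘ inj₁) w) (pushforward-cong≈ (vmap g) (z≋z′ ∘ inj₂) w)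
    ; +-hom  = λ z z′ w → ≡⇒≈ (trans (cong₂ _+_ (boundary-+ H (z ∘ inj₁) (z′ ∘ inj₁) w) (pushforward-+ (vmap g) (z ∘ inj₂) (z′ ∘ inj₂) w))
                                     (interchange (boundary H (z ∘ inj₁) w) (boundary H (z′ ∘ inj₁) w) _ _)) }

  module _ {G H : Graph} (g : Hom G H) where

    H1-injective⇒exact₂ : H1Iso p g → Exact (0ᴹ {⊥}) (∂cone₂ g)
    H1-injective⇒exact₂ (injective , _) a ∂a≋0 = (λ ()) , λ e → ≈-sym (mk≈ {a e} {0ℤ} (injective a cycle pushes-to-0 e))
      where
      cycle : IsCycle p G a
      cycle v = unmk≈ (≈-trans (≡⇒≈ (sym (ℤ.neg-involutive (boundary G a v)))) (-‿cong (∂a≋0 (inj₂ v))))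
      pushes-to-0 : ∀ x → push g a x ≡[mod p ] 0ℤ
      pushes-to-0 x = unmk≈ (∂a≋0 (inj₁ x))

    -- Write z = (z₁, z₂): z₂ has total sum 0 so z₂ = ∂b, then z₁ + g b is a cycle of H,
    -- which lifts to a cycle a′ of G; take a = a′ - b.
    H1-surjective⇒exact₁ : Connected G → V G → H1Iso p g → Exact (∂cone₂ g) (∂cone₁ g)
    H1-surjective⇒exact₁ connected a₀ (_ , surjective) z ∂z≋0 = a′ -ᶜ b , ∂a≋z
      where
      z₁ = z ∘ inj₁
      z₂ = z ∘ inj₂
      Σz₂≈0 : sumFin (nV G) z₂ ≈ 0ℤ
      Σz₂≈0 = begin
        sumFin (nV G) z₂                                        ≡⟨ sym (sumFin-pushforward (vmap g) z₂) ⟩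
        sumFin (nV H) (pushforward (vmap g) z₂)                 ≡⟨ sym (ℤ.+-identityˡ _) ⟩
        0ℤ + sumFin (nV H) (pushforward (vmap g) z₂)            ≡⟨ cong (_+ sumFin (nV H) (pushforward (vmap g) z₂)) (sym (sumFin-boundary H z₁)) ⟩
        sumFin (nV H) (boundary H z₁) + sumFin (nV H) (pushforward (vmap g) z₂)
                                                                ≡⟨ sym (sumFin-distrib-+ (nV H) (boundary H z₁) (pushforward (vmap g) z₂)) ⟩
        sumFin (nV H) (∂cone₁ g z)                              ≈⟨ sumFin-cong≈ (nV H) ∂z≋0 ⟩
        sumFin (nV H) (λ _ → 0ℤ)                                ≡⟨ sumFin-zero (nV H) ⟩
        0ℤ                                                      ∎
        where open ≈-Reasoning
      z₂∈im-∂ = zero-sum⇒boundary G connected a₀ z₂ Σz₂≈0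
      b = proj₁ z₂∈im-∂
      ∂b≈z₂ = proj₂ z₂∈im-∂
      y : Chain H
      y e = z₁ e + push g b e
      y-cycle : IsCycle p H y
      y-cycle w = unmk≈ (begin
        boundary H y w                                              ≡⟨ boundary-+ H z₁ (push g b) w ⟩
        boundary H z₁ w + boundary H (push g b) w                   ≡⟨ cong (_+_ (boundary H z₁ w)) (boundary-push g b w) ⟩
        boundary H z₁ w + pushforward (vmap g) (boundary G b) w     ≈⟨ +-congˡ (boundary H z₁ w) (pushforward-cong≈ (vmap g) ∂b≈z₂ w) ⟩
        ∂cone₁ g z w                                                ≈⟨ ∂z≋0 w ⟩
        0ℤ                                                          ∎)
        where open ≈-Reasoning
      y-lifted = surjective y y-cycle
      a′ = proj₁ y-lifted
      a′-cycle = proj₁ (proj₂ y-lifted)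
      a′↦y = proj₂ (proj₂ y-lifted)
      ∂a≋z : ∂cone₂ g (a′ -ᶜ b) ≋ z
      ∂a≋z (inj₁ x) = begin
        push g (a′ -ᶜ b) x                         ≡⟨ pushforward-- (emap g) a′ b x ⟩
        push g a′ x - push g b x                   ≈⟨ sub-congʳ (push g b x) (mk≈ {push g a′ x} {y x} (a′↦y x)) ⟩
        z₁ x + push g b x - push g b x             ≡⟨ cancel (z₁ x) (push g b x) ⟩
        z₁ x                                       ∎
        where
        open ≈-Reasoning
        cancel : ∀ s t → s + t - t ≡ s
        cancel = solve-∀
      ∂a≋z (inj₂ v) = begin
        - boundary G (a′ -ᶜ b) v                   ≡⟨ cong -_ (trans (boundary-+ G a′ (λ e → - b e) v) (cong (_+_ (boundary G a′ v)) (boundary-neg G b v))) ⟩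
        - (boundary G a′ v - boundary G b v)       ≈⟨ -‿cong (sub-cong (mk≈ {boundary G a′ v} {0ℤ} (a′-cycle v)) (∂b≈z₂ v)) ⟩
        - (0ℤ - z₂ v)                              ≡⟨ cancel (z₂ v) ⟩
        z₂ v                                       ∎
        where
        open ≈-Reasoning
        cancel : ∀ s → - (0ℤ - s) ≡ s
        cancel = solve-∀

    connected⇒exact₀ : Connected H → V G → Exact (∂cone₁ g) (0ᴹ {B = ⊥})
    connected⇒exact₀ connected a₀ u _ = z , ∂z≋u
      where
      K = sumFin (nV H) u
      z₂ : V G → ℤ
      z₂ w = K * ind a₀ w
      rest : V H → ℤ
      rest x = u x - pushforward (vmap g) z₂ x
      Σrest≡0 : sumFin (nV H) rest ≡ 0ℤ
      Σrest≡0 = begin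
        sumFin (nV H) rest                                            ≡⟨ sumFin-- (nV H) u (pushforward (vmap g) z₂) ⟩
        K - sumFin (nV H) (pushforward (vmap g) z₂)                   ≡⟨ cong (_-_ K) (sumFin-pushforward (vmap g) z₂) ⟩
        K - sumFin (nV G) z₂                                          ≡⟨ cong (_-_ K) (sym (*-distribˡ-sumFin (nV G) K (ind a₀))) ⟩
        K - K * sumFin (nV G) (ind a₀)                                ≡⟨ cong (λ t → K - K * t) (sumFin-indicator (nV G) a₀) ⟩
        K - K * 1ℤ                                                    ≡⟨ cong (_-_ K) (ℤ.*-identityʳ K) ⟩
        K - K                                                         ≡⟨ ℤ.+-inverseʳ K ⟩
        0ℤ                                                            ∎
        where open ≡-Reasoning
      rest∈im-∂ = zero-sum⇒boundary H connected (vmap g a₀) rest (≡⇒≈ Σrest≡0)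
      z : Ch (E H ⊎ V G)
      z (inj₁ e) = proj₁ rest∈im-∂ e
      z (inj₂ w) = z₂ w
      ∂z≋u : ∂cone₁ g z ≋ u
      ∂z≋u x = ≈-trans (+-congʳ (pushforward (vmap g) z₂ x) (proj₂ rest∈im-∂ x)) (≡⇒≈ (cancel (u x) (pushforward (vmap g) z₂ x)))
        where
        cancel : ∀ s t → s - t + t ≡ s
        cancel = solve-∀

    exact⇒H1Iso : Exact (0ᴹ {⊥}) (∂cone₂ g) → Exact (∂cone₂ g) (∂cone₁ g) → H1Iso p g
    exact⇒H1Iso exact₂ exact₁ = injective , surjective
      where
      injective : ∀ a → IsCycle p G a → (∀ x → push g a x ≡[mod p ] 0ℤ) → ∀ e → a e ≡[mod p ] 0ℤ
      injective a cycle pushes-to-0 e = unmk≈ (≈-sym (proj₂ (exact₂ a ∂a≋0) e))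
        where
        ∂a≋0 : ∂cone₂ g a ≋ 0ᶜ
        ∂a≋0 (inj₁ x) = mk≈ {push g a x} {0ℤ} (pushes-to-0 x)
        ∂a≋0 (inj₂ v) = -‿cong (mk≈ {boundary G a v} {0ℤ} (cycle v))
      surjective : ∀ z → IsCycle p H z → ∃ λ a → IsCycle p G a × (∀ x → push g a x ≡[mod p ] z x)
      surjective z cycle = a , (λ v → unmk≈ (≈-trans (≡⇒≈ (sym (ℤ.neg-involutive (boundary G a v)))) (-‿cong (∂a≋z (inj₂ v)))))
                             , λ x → unmk≈ (∂a≋z (inj₁ x))
        where
        z⁺ : Ch (E H ⊎ V G)
        z⁺ (inj₁ e) = z e
        z⁺ (inj₂ _) = 0ℤ
        ∂z⁺≋0 : ∂cone₁ g z⁺ ≋ 0ᶜ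
        ∂z⁺≋0 w = ≈-trans (≡⇒≈ (trans (cong (_+_ (boundary H z w)) (pushforward-zero (vmap g) w)) (ℤ.+-identityʳ (boundary H z w))))
                          (mk≈ {boundary H z w} {0ℤ} (cycle w))
        a∂ = exact₁ z⁺ ∂z⁺≋0
        a = proj₁ a∂
        ∂a≋z = proj₂ a∂

    exact⇒connected : Connected H → Exact (∂cone₂ g) (∂cone₁ g) → Connected G
    exact⇒connected connected exact₁ u v = boundary⇒path 1<p G u v a ∂a≈v-u
      where
      path = connected (vmap g u) (vmap g v)
      z : Ch (E H ⊎ V G)
      z (inj₁ e) = pathChain H path e
      z (inj₂ w) = ind u w - ind v w
      ∂z≋0 : ∂cone₁ g z ≋ 0ᶜ
      ∂z≋0 w = ≡⇒≈ (begin
        ∂cone₁ g z w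
          ≡⟨ cong₂ _+_ (boundary-pathChain H path w) (pushforward-- (vmap g) (ind u) (ind v) w) ⟩
        ind (vmap g v) w - ind (vmap g u) w + (pushforward (vmap g) (ind u) w - pushforward (vmap g) (ind v) w)
          ≡⟨ cong₂ (λ s t → ind (vmap g v) w - ind (vmap g u) w + (s - t)) (pushforward-ind (vmap g) u w) (pushforward-ind (vmap g) v w) ⟩
        ind (vmap g v) w - ind (vmap g u) w + (ind (vmap g u) w - ind (vmap g v) w)
          ≡⟨ cancel (ind (vmap g v) w) (ind (vmap g u) w) ⟩
        0ℤ ∎)
        where
        open ≡-Reasoning
        cancel : ∀ s t → s - t + (t - s) ≡ 0ℤ
        cancel = solve-∀
      a∂ = exact₁ z ∂z≋0
      a = proj₁ a∂
      ∂a≈v-u : ∀ w → boundary G a w ≈ ind v w - ind u w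
      ∂a≈v-u w = begin
        boundary G a w                 ≡⟨ sym (ℤ.neg-involutive (boundary G a w)) ⟩
        - - boundary G a w             ≈⟨ -‿cong (proj₂ a∂ (inj₂ w)) ⟩
        - (ind u w - ind v w)          ≡⟨ flip (ind u w) (ind v w) ⟩
        ind v w - ind u w              ∎
        where
        open ≈-Reasoning
        flip : ∀ s t → - (s - t) ≡ t - s
        flip = solve-∀


module LiftedCone (p-1 : ℕ) (p-prime : Prime (suc p-1)) where

  open ZpChains p-1 p-prime
  open ExactnessLifting p-1 p-prime
  open RegularCovers p-1 p-prime
  open ZpSetConstructions p-1 p-prime
  open MappingCone p-1 p-prime

  open FreeZpSet
  open Morphism

  module _ {A X Y P : Graph} (f : Hom A X) (c : Hom Y X) (cover : RegularCover p c)
           (πA : Hom P A) (f̂ : Hom P Y) (fibre-product : IsFiberProduct f c πA f̂) (x₀ : V X) where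

    open RegularCoverStructure c cover x₀ using (vertices; edges; deck)
    open IsFiberProduct fibre-product

    private
      module Pᵛ = Pullback vertices (vmap f) (vmap πA) (vmap f̂) v-comm v-inj v-surj
      module Pᵉ = Pullback edges (emap f) (emap πA) (emap f̂) e-comm e-inj e-surj

      σP-end : ∀ (end : ∀ G → E G → V G) →
               (∀ {G H} (h : Hom G H) e → end H (emap h e) ≡ vmap h (end G e)) →
               ∀ e → end P (Pᵉ.σ′ e) ≡ Pᵛ.σ′ (end P e)
      σP-end end end-hom e = v-inj _ _
        (begin
          vmap πA (end P (Pᵉ.σ′ e))      ≡⟨ sym (end-hom πA (Pᵉ.σ′ e)) ⟩
          end A (emap πA (Pᵉ.σ′ e))      ≡⟨ cong (end A) (Pᵉ.g′-σ′ e) ⟩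
          end A (emap πA e)              ≡⟨ end-hom πA e ⟩
          vmap πA (end P e)              ≡⟨ sym (Pᵛ.g′-σ′ (end P e)) ⟩
          vmap πA (Pᵛ.σ′ (end P e))      ∎)
        (begin
          vmap f̂ (end P (Pᵉ.σ′ e))       ≡⟨ sym (end-hom f̂ (Pᵉ.σ′ e)) ⟩
          end Y (emap f̂ (Pᵉ.σ′ e))       ≡⟨ cong (end Y) (Pᵉ.ĝ-σ′ e) ⟩
          end Y (emap deck (emap f̂ e))   ≡⟨ end-hom deck (emap f̂ e) ⟩
          vmap deck (end Y (emap f̂ e))   ≡⟨ cong (vmap deck) (end-hom f̂ e) ⟩
          vmap deck (vmap f̂ (end P e))   ≡⟨ sym (Pᵛ.ĝ-σ′ (end P e)) ⟩
          vmap f̂ (Pᵛ.σ′ (end P e))       ∎)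
        where open ≡-Reasoning

    S₂ : FreeZpSet (E P) (E A)
    S₂ = Pᵉ.structure

    S₁ : FreeZpSet (E Y ⊎ V P) (E X ⊎ V A)
    S₁ = edges ⊎ᶠ Pᵛ.structure

    S₀ : FreeZpSet (V Y) (V X)
    S₀ = vertices

    cone₂ : Morphism S₂ S₁
    cone₂ = record
      { up = ∂cone₂ f̂ ; down = ∂cone₂ f ; up-linear = ∂cone₂-linear f̂ ; down-linear = ∂cone₂-linear f
      ; equivariant = shift-commutes ; natural = commutes-with-π }
      where
      shift-commutes : ∀ a → ∂cone₂ f̂ (a ∘ σ S₂) ≋ ∂cone₂ f̂ a ∘ σ S₁
      shift-commutes a (inj₁ e) = ≡⇒≈ (pushforward-equivariant (emap f̂) (σσ⁻¹ S₂) (σ⁻¹σ S₂) (σσ⁻¹ edges) (σ⁻¹σ edges) Pᵉ.ĝ-σ′ a e)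
      shift-commutes a (inj₂ v) = ≡⇒≈ (cong -_ (boundary-equivariant P (σσ⁻¹ S₂) (σ⁻¹σ S₂) (σσ⁻¹ Pᵛ.structure) (σ⁻¹σ Pᵛ.structure)
                                                                  (σP-end src src-hom) (σP-end tgt tgt-hom) a v))
      commutes-with-π : ∀ a → π S₁ (∂cone₂ f̂ a) ≋ ∂cone₂ f (π S₂ a)
      commutes-with-π a (inj₁ x) = ≡⇒≈ (begin
        π S₁ (∂cone₂ f̂ a) (inj₁ x)                         ≡⟨ π-inj₁ edges Pᵛ.structure (∂cone₂ f̂ a) x ⟩
        π edges (push f̂ a) x                               ≡⟨ sym (pushforward-proj edges (push f̂ a) x) ⟩
        pushforward (emap c) (push f̂ a) x                  ≡⟨ pushforward-∘ (emap c) (emap f̂) a x ⟩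
        pushforward (emap c ∘ emap f̂) a x                  ≡⟨ pushforward-cong (λ e → sym (e-comm e)) a x ⟩
        pushforward (emap f ∘ emap πA) a x                 ≡⟨ sym (pushforward-∘ (emap f) (emap πA) a x) ⟩
        pushforward (emap f) (push πA a) x                 ≡⟨ pushforward-≗ (emap f) (pushforward-proj S₂ a) x ⟩
        push f (π S₂ a) x                                  ∎)
        where open ≡-Reasoning
      commutes-with-π a (inj₂ v) = ≡⇒≈ (begin
        π S₁ (∂cone₂ f̂ a) (inj₂ v)                         ≡⟨ π-inj₂ edges Pᵛ.structure (∂cone₂ f̂ a) v ⟩
        π Pᵛ.structure (λ w → - boundary P a w) v          ≡⟨ sym (pushforward-proj Pᵛ.structure (λ w → - boundary P a w) v) ⟩
        pushforward (vmap πA) (λ w → - boundary P a w) v   ≡⟨ pushforward-neg (vmap πA) (boundary P a) v ⟩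
        - pushforward (vmap πA) (boundary P a) v           ≡⟨ cong -_ (sym (boundary-push πA a v)) ⟩
        - boundary A (push πA a) v                         ≡⟨ cong -_ (boundary-≗ A (pushforward-proj S₂ a) v) ⟩
        - boundary A (π S₂ a) v                            ∎)
        where open ≡-Reasoning

    cone₁ : Morphism S₁ S₀
    cone₁ = record
      { up = ∂cone₁ f̂ ; down = ∂cone₁ f ; up-linear = ∂cone₁-linear f̂ ; down-linear = ∂cone₁-linear f
      ; equivariant = shift-commutes ; natural = commutes-with-π }
      where
      shift-commutes : ∀ z → ∂cone₁ f̂ (z ∘ σ S₁) ≋ ∂cone₁ f̂ z ∘ σ S₀
      shift-commutes z w = ≡⇒≈ (cong₂ _+_
        (boundary-equivariant Y (σσ⁻¹ edges) (σ⁻¹σ edges) (σσ⁻¹ vertices) (σ⁻¹σ vertices) (src-hom deck) (tgt-hom deck) (z ∘ inj₁) w)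
        (pushforward-equivariant (vmap f̂) (σσ⁻¹ Pᵛ.structure) (σ⁻¹σ Pᵛ.structure) (σσ⁻¹ vertices) (σ⁻¹σ vertices) Pᵛ.ĝ-σ′ (z ∘ inj₂) w))
      commutes-with-π : ∀ z → π S₀ (∂cone₁ f̂ z) ≋ ∂cone₁ f (π S₁ z)
      commutes-with-π z x = ≡⇒≈ (begin
        π vertices (∂cone₁ f̂ z) x
          ≡⟨ sym (pushforward-proj vertices (∂cone₁ f̂ z) x) ⟩
        pushforward (vmap c) (∂cone₁ f̂ z) x
          ≡⟨ pushforward-+ (vmap c) (boundary Y (z ∘ inj₁)) (pushforward (vmap f̂) (z ∘ inj₂)) x ⟩
        pushforward (vmap c) (boundary Y (z ∘ inj₁)) x + pushforward (vmap c) (pushforward (vmap f̂) (z ∘ inj₂)) x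
          ≡⟨ cong₂ _+_ (sym (boundary-push c (z ∘ inj₁) x)) (pushforward-∘ (vmap c) (vmap f̂) (z ∘ inj₂) x) ⟩
        boundary X (push c (z ∘ inj₁)) x + pushforward (vmap c ∘ vmap f̂) (z ∘ inj₂) x
          ≡⟨ cong (_+_ (boundary X (push c (z ∘ inj₁)) x))
                  (trans (pushforward-cong (λ w → sym (v-comm w)) (z ∘ inj₂) x) (sym (pushforward-∘ (vmap f) (vmap πA) (z ∘ inj₂) x))) ⟩
        boundary X (push c (z ∘ inj₁)) x + pushforward (vmap f) (pushforward (vmap πA) (z ∘ inj₂)) x
          ≡⟨ cong₂ _+_ (boundary-≗ X (λ e → trans (pushforward-proj edges (z ∘ inj₁) e) (sym (π-inj₁ edges Pᵛ.structure z e))) x)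
                       (pushforward-≗ (vmap f) (λ v → trans (pushforward-proj Pᵛ.structure (z ∘ inj₂) v)
                                                           (sym (π-inj₂ edges Pᵛ.structure z v))) x) ⟩
        ∂cone₁ f (π S₁ z) x ∎)
        where open ≡-Reasoning

    from-∅ : Morphism ∅ᶠ S₂
    from-∅ = record
      { up = 0ᴹ ; down = 0ᴹ ; up-linear = 0ᴹ-linear ; down-linear = 0ᴹ-linear
      ; equivariant = λ _ _ → ≈-refl ; natural = λ _ → Linear.0-hom (π-linear S₂) }

    to-∅ : Morphism S₀ ∅ᶠ
    to-∅ = record
      { up = 0ᴹ ; down = 0ᴹ ; up-linear = 0ᴹ-linear ; down-linear = 0ᴹ-linear
      ; equivariant = λ _ () ; natural = λ _ () }

    exact-cone-lifts : Exact (0ᴹ {⊥}) (∂cone₂ f) → Exact (∂cone₂ f) (∂cone₁ f) → Exact (∂cone₁ f) (0ᴹ {B = ⊥}) →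
                       Exact (0ᴹ {⊥}) (∂cone₂ f̂) × Exact (∂cone₂ f̂) (∂cone₁ f̂)
    exact-cone-lifts exact₂ exact₁ exact₀ =
      exact↑ from-∅ cone₂ cone₁ (λ _ → Linear.0-hom (∂cone₂-linear f̂)) ∂∂≋0 exact₂ exact₁ ,
      exact↑ cone₂ cone₁ to-∅ ∂∂≋0 (λ _ ()) exact₁ exact₀
      where
      ∂∂≋0 : ∀ a → ∂cone₁ f̂ (∂cone₂ f̂ a) ≋ 0ᶜ
      ∂∂≋0 a w = ≡⇒≈ (∂cone₁∘∂cone₂≡0 f̂ a w)

    lift-connected-H1Iso : Connected A → Connected X → V A → H1Iso p f → Connected P × H1Iso p f̂
    lift-connected-H1Iso A-connected X-connected a₀ f-iso =
      exact⇒connected f̂ (RegularCover.connected cover) (proj₂ lifted) , exact⇒H1Iso f̂ (proj₁ lifted) (proj₂ lifted)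
      where
      lifted = exact-cone-lifts (H1-injective⇒exact₂ f f-iso) (H1-surjective⇒exact₁ f A-connected a₀ f-iso)
                                (connected⇒exact₀ f X-connected a₀)

  -- The path from v₀ to σ v₀ in the cover projects to a cycle z.  The coordinate function
  -- φ on vertices of Y has σ-invariant differences along edges (mod p), so they factor through
  -- edges of X; pairing then gives 1 = φ (σ v₀) - φ v₀ = ⟨z, θ⟩, hence z ≢ 0.
  cover⇒nonzero-cycle : ∀ {Y X} (c : Hom Y X) → RegularCover p c → V X →
                        Σ (Chain X) λ z → IsCycle p X z × ¬ (∀ x → z x ≈ 0ℤ)
  cover⇒nonzero-cycle {Y} {X} c cover x₀ = push c γ , z-cycle , z≉0
    where
    open RegularCoverStructure c cover x₀ using (vertices; edges; deck)
    open RegularCover cover using (connected)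
    v₀ v₁ : V Y
    v₀ = section vertices x₀
    v₁ = vmap deck v₀
    path = connected v₀ v₁
    γ = pathChain Y path
    z-cycle : IsCycle p X (push c γ)
    z-cycle x = unmk≈ (≡⇒≈ (begin
      boundary X (push c γ) x                                        ≡⟨ boundary-push c γ x ⟩
      pushforward (vmap c) (boundary Y γ) x                          ≡⟨ pushforward-≗ (vmap c) (boundary-pathChain Y path) x ⟩
      pushforward (vmap c) (λ w → ind v₁ w - ind v₀ w) x             ≡⟨ pushforward-- (vmap c) (ind v₁) (ind v₀) x ⟩
      pushforward (vmap c) (ind v₁) x - pushforward (vmap c) (ind v₀) x
                                                                     ≡⟨ cong₂ _-_ (pushforward-ind (vmap c) v₁ x) (pushforward-ind (vmap c) v₀ x) ⟩
      ind (vmap c v₁) x - ind (vmap c v₀) x                          ≡⟨ cong (λ y → ind y x - ind (vmap c v₀) x) (proj-σ vertices v₀) ⟩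
      ind (vmap c v₀) x - ind (vmap c v₀) x                          ≡⟨ ℤ.+-inverseʳ (ind (vmap c v₀) x) ⟩
      0ℤ                                                             ∎))
      where open ≡-Reasoning
    φ : V Y → ℤ
    φ w = + coord vertices w
    δ : E Y → ℤ
    δ e = φ (tgt Y e) - φ (src Y e)
    δ-invariant : N edges δ ≋ 0ᶜ
    δ-invariant e = begin
      δ (emap deck e) - δ e                                              ≡⟨ cong₂ (λ s t → φ s - φ t - δ e) (tgt-hom deck e) (src-hom deck e) ⟩
      φ (vmap deck (tgt Y e)) - φ (vmap deck (src Y e)) - δ e            ≈⟨ sub-congʳ (δ e) (sub-cong (coord-σ≈ vertices (tgt Y e)) (coord-σ≈ vertices (src Y e))) ⟩
      (φ (tgt Y e) + 1ℤ) - (φ (src Y e) + 1ℤ) - δ e                      ≡⟨ shift-cancels (φ (tgt Y e)) (φ (src Y e)) ⟩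
      0ℤ                                                                 ∎
      where
      open ≈-Reasoning
      shift-cancels : ∀ s t → (s + 1ℤ) - (t + 1ℤ) - (s - t) ≡ 0ℤ
      shift-cancels = solve-∀
    θ : E X → ℤ
    θ x = δ (section edges x)
    δ≈θ∘c : ∀ e → δ e ≈ θ (emap c e)
    δ≈θ∘c e = ≈-trans (≡⇒≈ (cong δ (sym (σ^coord edges e)))) (σ-invariant edges δ δ-invariant (coord edges e) (section edges (emap c e)))
    z≉0 : ¬ (∀ x → push c γ x ≈ 0ℤ)
    z≉0 z≈0 = 1≉0 1<p (begin
      1ℤ                                                   ≡⟨ cong₂ (λ s t → + s - + t) (sym (coord-σ^ vertices x₀ 1 1<p)) (sym (coord-section vertices x₀)) ⟩
      φ v₁ - φ v₀                                          ≡⟨ sym (sumFin-ind-difference (nV Y) v₀ v₁ φ) ⟩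
      sumFin (nV Y) (λ w → (ind v₁ w - ind v₀ w) * φ w)    ≡⟨ sym (sumFin-cong (nV Y) (λ w → cong (_* φ w) (boundary-pathChain Y path w))) ⟩
      sumFin (nV Y) (λ w → boundary Y γ w * φ w)           ≡⟨ boundary-pairing Y γ φ ⟩
      sumFin (nE Y) (λ e → γ e * δ e)                      ≈⟨ sumFin-cong≈ (nE Y) (λ e → *-congˡ (γ e) (δ≈θ∘c e)) ⟩
      sumFin (nE Y) (λ e → γ e * θ (emap c e))             ≡⟨ sym (pushforward-pairing (emap c) γ θ) ⟩
      sumFin (nE X) (λ x → push c γ x * θ x)               ≈⟨ sumFin-cong≈ (nE X) (λ x → *-congʳ (θ x) (z≈0 x)) ⟩
      sumFin (nE X) (λ x → 0ℤ * θ x)                       ≡⟨ trans (sumFin-cong (nE X) (λ x → ℤ.*-zeroˡ (θ x))) (sumFin-zero (nE X)) ⟩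
      0ℤ                                                   ∎)
      where open ≈-Reasoning

  H1-surjective⇒source-nonempty : ∀ {A X Y} (f : Hom A X) (c : Hom Y X) → H1Iso p f → RegularCover p c → V X → ¬ ¬ V A
  H1-surjective⇒source-nonempty {A} f c f-iso cover x₀ A-empty =
    z≉0 λ x → ≈-trans (≈-sym (mk≈ {push f a x} {z x} (a↦z x)))
                      (≡⇒≈ (sumFin-empty (nE A) (λ e → a e * ind (emap f e) x) λ e → A-empty (src A e)))
    where
    nonzero = cover⇒nonzero-cycle c cover x₀
    z = proj₁ nonzero
    z≉0 = proj₂ (proj₂ nonzero)
    lifted = proj₂ f-iso z (proj₁ (proj₂ nonzero))
    a = proj₁ lifted
    a↦z = proj₂ (proj₂ lifted)


inhabited? : ∀ n → Dec (Fin n)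
inhabited? zero    = no λ ()
inhabited? (suc n) = yes zero

over-empty-base : ∀ {p A X X′ P} (f : Hom A X) (c : Hom X′ X) (πA : Hom P A) (f̂ : Hom P X′) →
                  ¬ V X → Connected P × H1Iso p f̂
over-empty-base {X′ = X′} {P} f c πA f̂ X-empty =
  (λ u → ⊥-elim (X-empty (vmap f (vmap πA u)))) ,
  (λ _ _ _ e → ⊥-elim (X-empty (vmap f (vmap πA (src P e))))) ,
  λ _ _ → (λ _ → 0ℤ) , (λ v → ⊥-elim (X-empty (vmap f (vmap πA v)))) , λ x → ⊥-elim (X-empty (vmap c (src X′ x)))

corollary6p3 : (p : ℕ) → Prime p →
    (A X : Graph) (f : Hom A X) → Connected A → Connected X →
    Immersion f → H1Iso p f →
    (X' : Graph) (c : Hom X' X) → RegularCover p c →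
    (P : Graph) (πA : Hom P A) (f̂ : Hom P X') → IsFiberProduct f c πA f̂ →
    Connected P × H1Iso p f̂
corollary6p3 zero p-prime = ⊥-elim (¬prime[0] p-prime)
corollary6p3 (suc p-1) p-prime A X f A-connected X-connected _ f-iso X′ c cover P πA f̂ fibre-product
  with inhabited? (nV X) | inhabited? (nV A)
... | no X-empty | _      = over-empty-base f c πA f̂ X-empty
... | yes x₀     | no ¬a₀ = ⊥-elim (LiftedCone.H1-surjective⇒source-nonempty p-1 p-prime f c f-iso cover x₀ ¬a₀)
... | yes x₀     | yes a₀ =
  LiftedCone.lift-connected-H1Iso p-1 p-prime f c cover πA f̂ fibre-product x₀ A-connected X-connected a₀ f-iso
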